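{- For every integer $r\ge 1$ let $\mathscr{P}_{B_r}(q)$ be the $q$-analog of Kostant's partition function evaluated at the highest root of type $B_r$ (defined in the context). Then, as formal power series in $x$ with coefficients in $\mathbb{Z}[q]$, \[ \sum_{r\geq 1}\mathscr{P}_{B_r}(q)x^r=\frac{qx+(-q-q^2)x^2+q^2x^3}{1-(2+2q+q^2)x+(1+2q+q^2+q^3)x^2}. \]
   Context: Type $B_r$ (the Lie algebra $\mathfrak{so}_{2r+1}(\mathbb{C})$), $r\ge1$: with simple roots $\alpha_1,\dots,\alpha_r$, the positive roots are the "nonhooked" roots $\alpha_i+\alpha_{i+1}+\cdots+\alpha_j$ for $1\le i\le j\le r$ and the "hooked" roots $\alpha_i+\cdots+\alpha_{j-1}+2\alpha_j+2\alpha_{j+1}+\cdots+2\alpha_r$ for $1\le i<j\le r$. The highest root is $\tilde\alpha=\alpha_1+2\alpha_2+\cdots+2\alpha_r$ (for $r=1$ it is $\alpha_1$). A partition of $\tilde\alpha$ with $k$ parts is a multiset $\{\beta_1,\dots,\beta_k\}$ of positive roots (repetitions allowed) with $\beta_1+\cdots+\beta_k=\tilde\alpha$. The $q$-analog of Kostant's partition function at $\tilde\alpha$ is $\mathscr{P}_{B_r}(q)=\sum_{k\ge1}a_kq^k$, where $a_k$ is the number of partitions of $\tilde\alpha$ with exactly $k$ parts. -}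

module Defs where

open import Data.Nat as ℕ using (ℕ; zero; suc; _∸_; _≤ᵇ_; _≡ᵇ_)
open import Data.Integer as ℤ using (ℤ; +_; -_)
open import Data.Bool using (Bool; true; false; if_then_else_; _∧_)
open import Data.List using (List; []; _∷_; upTo; map; concatMap; foldr)
open import Data.Vec using (Vec; tabulate; zipWith)
open import Data.Fin using (Fin; toℕ)

-- Positive roots of B_r, written in the basis of simple roots
-- α₁,…,α_r as coefficient vectors (component l, 0-indexed, is the
-- coefficient of α_{l+1}).  Indices i, j below are 1-based as in the paper.

nonhooked : (r i j : ℕ) → Vec ℕ r
nonhooked r i j = tabulate λ l →
  if (i ≤ᵇ suc (toℕ l)) ∧ (suc (toℕ l) ≤ᵇ j) then 1 else 0

-- hooked: α_i + … + α_{j-1} + 2α_j + … + 2α_r   (1 ≤ i < j ≤ r)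
hooked : (r i j : ℕ) → Vec ℕ r
hooked r i j = tabulate λ l →
  if suc (toℕ l) ≤ᵇ (j ∸ 1) then (if i ≤ᵇ suc (toℕ l) then 1 else 0) else 2

oneTo : ℕ → List ℕ
oneTo r = map suc (upTo r)

positiveRoots : (r : ℕ) → List (Vec ℕ r)
positiveRoots r =
  concatMap (λ i → concatMap (λ j →
      (if i ≤ᵇ j then nonhooked r i j ∷ [] else [])
      Data.List.++ (if suc i ≤ᵇ j then hooked r i j ∷ [] else []))
    (oneTo r)) (oneTo r)

highestRoot : (r : ℕ) → Vec ℕ r
highestRoot r = tabulate λ l → if toℕ l ≡ᵇ 0 then 1 else 2

leqV : ∀ {r} → Vec ℕ r → Vec ℕ r → Bool
leqV u v = foldrV (zipWith _≤ᵇ_ u v)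
  where
  foldrV : ∀ {n} → Vec Bool n → Bool
  foldrV Vec.[] = true
  foldrV (b Vec.∷ bs) = b ∧ foldrV bs

isZeroV : ∀ {r} → Vec ℕ r → Bool
isZeroV Vec.[] = true
isZeroV (x Vec.∷ v) = (x ≡ᵇ 0) ∧ isZeroV v

subV : ∀ {r} → Vec ℕ r → Vec ℕ r → Vec ℕ r
subV = zipWith _∸_

scaleV : ∀ {r} → ℕ → Vec ℕ r → Vec ℕ r
scaleV m = Data.Vec.map (m ℕ.*_)

sumℕ : List ℕ → ℕ
sumℕ = foldr ℕ._+_ 0

-- countPartitions βs t k : the number of multisets of elements of the
-- list βs (of distinct vectors), with exactly k elements counted with
-- multiplicity, whose sum is t.

countPartitions : ∀ {r} → List (Vec ℕ r) → Vec ℕ r → ℕ → ℕ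
countPartitions [] t k = if isZeroV t ∧ (k ≡ᵇ 0) then 1 else 0
countPartitions (β ∷ βs) t k =
  sumℕ (map (λ m → if leqV (scaleV m β) t
                     then countPartitions βs (subV t (scaleV m β)) (k ∸ m)
                     else 0)
            (upTo (suc k)))

partitionsB : (r k : ℕ) → ℕ
partitionsB r k = countPartitions (positiveRoots r) (highestRoot r) k

-- Polynomials in q over ℤ as coefficient sequences, formal power
-- series in x over ℤ[q] as sequences of polynomials.

Poly : Set
Poly = ℕ → ℤ

sumℤ : List ℤ → ℤ
sumℤ = foldr ℤ._+_ (+ 0)

_*ₚ_ : Poly → Poly → Poly
(p *ₚ q) n = sumℤ (map (λ i → p i ℤ.* q (n ∸ i)) (upTo (suc n)))

_+ₚ_ : Poly → Poly → Poly
(p +ₚ q) n = p n ℤ.+ q n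

0ₚ : Poly
0ₚ _ = + 0

Series : Set
Series = ℕ → Poly

sumP : List Poly → Poly
sumP = foldr _+ₚ_ 0ₚ

_*ₛ_ : Series → Series → Series
(f *ₛ g) n = sumP (map (λ i → f i *ₚ g (n ∸ i)) (upTo (suc n)))

poly : List ℤ → Poly
poly [] _ = + 0
poly (c ∷ cs) zero = c
poly (c ∷ cs) (suc n) = poly cs n

qKostantB : ℕ → Poly
qKostantB r zero = + 0
qKostantB r (suc k) = + partitionsB r (suc k)

genSeries : Series
genSeries zero = 0ₚ
genSeries (suc r) = qKostantB (suc r)

numerator : Series
numerator 1 = poly (+ 0 ∷ + 1 ∷ [])
numerator 2 = poly (+ 0 ∷ - + 1 ∷ - + 1 ∷ [])
numerator 3 = poly (+ 0 ∷ + 0 ∷ + 1 ∷ [])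
numerator _ = 0ₚ

denominator : Series
denominator 0 = poly (+ 1 ∷ [])
denominator 1 = poly (- + 2 ∷ - + 2 ∷ - + 1 ∷ [])
denominator 2 = poly (+ 1 ∷ + 2 ∷ + 1 ∷ + 1 ∷ [])
denominator _ = 0ₚ

module Submission where

-- The roots of B_{r+1} with α₁-coefficient 1 are α₁, α₁+…+α_{c+1} and
-- α₁+…+α_{d+1}+2α_{d+2}+…+2α_{r+1}; the others are the roots of B_r on α₂,…,α_{r+1}.
-- Splitting off the first coordinate of a target of shape 0^z 1^o v^* (v ∈ {0, 2})
-- thus expresses partition counts in B_{r+1} through counts of the same shapes in
-- B_r.  By induction on the rank the counts are explicit polynomials in q: γ o for
-- 0^z 1^o 0^*, Φ o m for 0^z 1^o 2^m, and Q m for 2^m, with an auxiliary S m.  As the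
-- highest root is 1 2^r, P_{B_{r+1}} = q (Q r + S r), and for r ≥ 1 the pair (Q r, S r)
-- evolves by a 2×2 matrix of trace 2+2q+q² and determinant 1+2q+q²+q³.  Its
-- Cayley–Hamilton identity is the recurrence of the denominator; the coefficients of
-- x, x², x³ are computed directly.

open import Defs
open import Data.Nat using (ℕ; zero; suc; _+_; _*_; _∸_; _≤_; _<_; _≤ᵇ_; _<ᵇ_; _≡ᵇ_; z≤n; s≤s)
open import Data.Nat.Properties
open import Data.Bool using (Bool; true; false; if_then_else_; _∧_; T)
open import Data.Bool.Properties using (∧-zeroʳ; T-≡)
open import Data.Unit using (tt)
open import Data.Empty using (⊥-elim)
open import Function.Bundles using (Equivalence)
open import Data.List using (List; []; _∷_; _++_; map; applyUpTo; upTo; concatMap)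
open import Data.List.Properties using (map-applyUpTo; map-upTo; concatMap-map; map-concatMap; concatMap-cong)
open import Data.Vec using (Vec) renaming ([] to []ᵥ; _∷_ to _∷ᵥ_)
open import Data.Vec.Properties using (tabulate-cong)
import Data.Vec as V
open import Data.Fin using (toℕ)
open import Relation.Binary.PropositionalEquality
open import Function using (_∘_; id)
open import Data.Nat.Tactic.RingSolver using (solve-∀)
open import Algebra.Properties.CommutativeSemigroup +-commutativeSemigroup using (interchange; xy∙z≈xz∙y)
open import Data.Integer using (ℤ) renaming (_+_ to _+ℤ_; _*_ to _*ℤ_; _-_ to _-ℤ_)
import Data.Integer as ℤ
import Data.Integer.Properties as ℤₚ
import Data.Integer.Tactic.RingSolver as ℤ-Solver

Σ : ℕ → (ℕ → ℕ) → ℕ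
Σ zero    f = 0
Σ (suc n) f = Σ n f + f n

Σ-head : ∀ n (f : ℕ → ℕ) → Σ (suc n) f ≡ f 0 + Σ n (f ∘ suc)
Σ-head zero    f = +-comm 0 (f 0)
Σ-head (suc n) f = trans (cong (_+ f (suc n)) (Σ-head n f)) (+-assoc (f 0) _ _)

Σ-cong : ∀ n {f g : ℕ → ℕ} → (∀ i → i < n → f i ≡ g i) → Σ n f ≡ Σ n g
Σ-cong zero    h = refl
Σ-cong (suc n) h = cong₂ _+_ (Σ-cong n (λ i i<n → h i (m≤n⇒m≤1+n i<n))) (h n ≤-refl)

Σ-cong′ : ∀ n {f g : ℕ → ℕ} → (∀ i → f i ≡ g i) → Σ n f ≡ Σ n g
Σ-cong′ n h = Σ-cong n (λ i _ → h i)

Σ-zero : ∀ n (f : ℕ → ℕ) → (∀ i → i < n → f i ≡ 0) → Σ n f ≡ 0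
Σ-zero zero    f h = refl
Σ-zero (suc n) f h = cong₂ _+_ (Σ-zero n f (λ i i<n → h i (m≤n⇒m≤1+n i<n))) (h n ≤-refl)

Σ-+ : ∀ n (f g : ℕ → ℕ) → Σ n (λ i → f i + g i) ≡ Σ n f + Σ n g
Σ-+ zero    f g = refl
Σ-+ (suc n) f g = trans (cong (_+ (f n + g n)) (Σ-+ n f g)) (interchange (Σ n f) (Σ n g) (f n) (g n))

Σ-split : ∀ a b (f : ℕ → ℕ) → Σ (a + b) f ≡ Σ a f + Σ b (λ i → f (a + i))
Σ-split a zero    f = trans (cong (λ n → Σ n f) (+-identityʳ a)) (sym (+-identityʳ _))
Σ-split a (suc b) f = trans (cong (λ n → Σ n f) (+-suc a b))
  (trans (cong (_+ f (a + b)) (Σ-split a b f)) (+-assoc (Σ a f) _ _))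

Σ-reverse : ∀ n (f : ℕ → ℕ) → Σ n (λ i → f (n ∸ suc i)) ≡ Σ n f
Σ-reverse zero    f = refl
Σ-reverse (suc n) f = trans (Σ-head n (λ i → f (suc n ∸ suc i)))
  (trans (cong (f n +_) (Σ-reverse n f)) (+-comm (f n) (Σ n f)))

-- Polynomials in q with coefficients in ℕ are coefficient sequences ℕ → ℕ;
-- δ is the polynomial 1 and shift is multiplication by q.

δ : ℕ → ℕ
δ k = if k ≡ᵇ 0 then 1 else 0

shift : (ℕ → ℕ) → ℕ → ℕ
shift f zero    = 0
shift f (suc k) = f k

shift-cong : ∀ {f g : ℕ → ℕ} → (∀ k → f k ≡ g k) → ∀ k → shift f k ≡ shift g k
shift-cong h zero    = refl
shift-cong h (suc k) = h k

shift-+ : ∀ (f g : ℕ → ℕ) k → shift (λ k → f k + g k) k ≡ shift f k + shift g k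
shift-+ f g zero    = refl
shift-+ f g (suc k) = refl

shift-Σ : ∀ n (F : ℕ → ℕ → ℕ) k → shift (λ k → Σ n (λ i → F i k)) k ≡ Σ n (λ i → shift (F i) k)
shift-Σ n F zero    = sym (Σ-zero n _ (λ i _ → refl))
shift-Σ n F (suc k) = refl

shift-zero : ∀ (f : ℕ → ℕ) → (∀ k → f k ≡ 0) → ∀ k → shift f k ≡ 0
shift-zero f h zero    = refl
shift-zero f h (suc k) = h k

usingTimes : ∀ {r} → Vec ℕ r → List (Vec ℕ r) → Vec ℕ r → ℕ → ℕ → ℕ
usingTimes β βs t k m =
  if leqV (scaleV m β) t then countPartitions βs (subV t (scaleV m β)) (k ∸ m) else 0

sumℕ-applyUpTo-zero : ∀ (f : ℕ → ℕ) n → (∀ m → f m ≡ 0) → sumℕ (applyUpTo f n) ≡ 0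
sumℕ-applyUpTo-zero f zero    h = refl
sumℕ-applyUpTo-zero f (suc n) h = cong₂ _+_ (h 0) (sumℕ-applyUpTo-zero (f ∘ suc) n (h ∘ suc))

applyUpTo-cong : ∀ {f g : ℕ → ℕ} n → (∀ m → f m ≡ g m) → applyUpTo f n ≡ applyUpTo g n
applyUpTo-cong zero    h = refl
applyUpTo-cong (suc n) h = cong₂ _∷_ (h 0) (applyUpTo-cong n (h ∘ suc))

countPartitions-cons : ∀ {r} (β : Vec ℕ r) βs t k →
  countPartitions (β ∷ βs) t k ≡ sumℕ (applyUpTo (usingTimes β βs t k) (suc k))
countPartitions-cons β βs t k = cong sumℕ (map-upTo (usingTimes β βs t k) (suc k))

countRest : ∀ {r} → List (Vec ℕ r) → Vec ℕ r → ℕ → Vec ℕ r → ℕ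
countRest B t k β = if leqV β t then countPartitions B (subV t β) k else 0

if-cong : ∀ {b b′ : Bool} {x x′ : ℕ} → b ≡ b′ → x ≡ x′ → (if b then x else 0) ≡ (if b′ then x′ else 0)
if-cong refl refl = refl

if-zero : ∀ {b : Bool} {x : ℕ} → x ≡ 0 → (if b then x else 0) ≡ 0
if-zero {true}  e = e
if-zero {false} e = refl

if-true : ∀ {b : Bool} {x : ℕ} → b ≡ true → (if b then x else 0) ≡ x
if-true refl = refl

if-false : ∀ {b : Bool} {x : ℕ} → b ≡ false → (if b then x else 0) ≡ 0
if-false refl = refl

scaleV-0-leqV : ∀ {r} (β t : Vec ℕ r) → leqV (scaleV 0 β) t ≡ true
scaleV-0-leqV []ᵥ       []ᵥ       = refl
scaleV-0-leqV (b ∷ᵥ β) (x ∷ᵥ t) = scaleV-0-leqV β t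

scaleV-0-subV : ∀ {r} (β t : Vec ℕ r) → subV t (scaleV 0 β) ≡ t
scaleV-0-subV []ᵥ       []ᵥ       = refl
scaleV-0-subV (b ∷ᵥ β) (x ∷ᵥ t) = cong (x ∷ᵥ_) (scaleV-0-subV β t)

scaleV-1 : ∀ {r} (β : Vec ℕ r) → scaleV 1 β ≡ β
scaleV-1 []ᵥ       = refl
scaleV-1 (b ∷ᵥ β) = cong₂ _∷ᵥ_ (+-identityʳ b) (scaleV-1 β)

usingTimes-0 : ∀ {r} (β : Vec ℕ r) βs t k → usingTimes β βs t k 0 ≡ countPartitions βs t k
usingTimes-0 β βs t k =
  if-cong {x′ = countPartitions βs t k} (scaleV-0-leqV β t) (cong (λ u → countPartitions βs u k) (scaleV-0-subV β t))

usingTimes-1 : ∀ {r} (β : Vec ℕ r) βs t k → usingTimes β βs t (suc k) 1 ≡ countRest βs t k β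
usingTimes-1 β βs t k = cong (λ β′ → if leqV β′ t then countPartitions βs (subV t β′) k else 0) (scaleV-1 β)

-- Roots of B_{r+1} are split according to their α₁-coefficient, 0 or 1.

lead0 : ∀ {r} → List (Vec ℕ r) → List (Vec ℕ (suc r))
lead0 = map (0 ∷ᵥ_)

lead1 : ∀ {r} → List (Vec ℕ r) → List (Vec ℕ (suc r))
lead1 = map (1 ∷ᵥ_)

leqV-lead0 : ∀ {r} m x (β t : Vec ℕ r) → leqV (scaleV m (0 ∷ᵥ β)) (x ∷ᵥ t) ≡ leqV (scaleV m β) t
leqV-lead0 m x β t = cong (λ z → (z ≤ᵇ x) ∧ leqV (scaleV m β) t) (*-zeroʳ m)

subV-lead0 : ∀ {r} m x (β t : Vec ℕ r) → subV (x ∷ᵥ t) (scaleV m (0 ∷ᵥ β)) ≡ x ∷ᵥ subV t (scaleV m β)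
subV-lead0 m x β t = cong (λ z → (x ∸ z) ∷ᵥ subV t (scaleV m β)) (*-zeroʳ m)

count-lead0 : ∀ {r} (B : List (Vec ℕ r)) t k → countPartitions (lead0 B) (0 ∷ᵥ t) k ≡ countPartitions B t k
count-lead0 []      t k = refl
count-lead0 (β ∷ B) t k =
  trans (countPartitions-cons (0 ∷ᵥ β) (lead0 B) (0 ∷ᵥ t) k)
    (trans (cong sumℕ (applyUpTo-cong (suc k) summand)) (sym (countPartitions-cons β B t k)))
  where
  summand : ∀ m → usingTimes (0 ∷ᵥ β) (lead0 B) (0 ∷ᵥ t) k m ≡ usingTimes β B t k m
  summand m = if-cong (leqV-lead0 m 0 β t)
    (trans (cong (λ u → countPartitions (lead0 B) u (k ∸ m)) (subV-lead0 m 0 β t)) (count-lead0 B _ _))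

count-lead0-positive : ∀ {r} (B : List (Vec ℕ r)) x t k → countPartitions (lead0 B) (suc x ∷ᵥ t) k ≡ 0
count-lead0-positive []      x t k = refl
count-lead0-positive (β ∷ B) x t k =
  trans (countPartitions-cons (0 ∷ᵥ β) (lead0 B) (suc x ∷ᵥ t) k) (sumℕ-applyUpTo-zero _ (suc k) summand)
  where
  summand : ∀ m → usingTimes (0 ∷ᵥ β) (lead0 B) (suc x ∷ᵥ t) k m ≡ 0
  summand m = if-zero
    (trans (cong (λ u → countPartitions (lead0 B) u (k ∸ m)) (subV-lead0 m (suc x) β t)) (count-lead0-positive B x _ _))

count-target0 : ∀ {r} (A B : List (Vec ℕ r)) t k →
  countPartitions (lead1 A ++ lead0 B) (0 ∷ᵥ t) k ≡ countPartitions B t k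
count-target0 []      B t k = count-lead0 B t k
count-target0 (β ∷ A) B t k = begin
  countPartitions (lead1 (β ∷ A) ++ lead0 B) (0 ∷ᵥ t) k
    ≡⟨ countPartitions-cons (1 ∷ᵥ β) (lead1 A ++ lead0 B) (0 ∷ᵥ t) k ⟩
  usingTimes (1 ∷ᵥ β) (lead1 A ++ lead0 B) (0 ∷ᵥ t) k 0 + sumℕ (applyUpTo (λ m → 0) k)
    ≡⟨ cong₂ _+_ (usingTimes-0 (1 ∷ᵥ β) (lead1 A ++ lead0 B) (0 ∷ᵥ t) k) (sumℕ-applyUpTo-zero _ k (λ _ → refl)) ⟩
  countPartitions (lead1 A ++ lead0 B) (0 ∷ᵥ t) k + 0
    ≡⟨ trans (+-identityʳ _) (count-target0 A B t k) ⟩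
  countPartitions B t k ∎
  where open ≡-Reasoning

-- A target with leading coordinate 1 uses exactly one root with leading coordinate 1.
count-target1-nil : ∀ {r} (A B : List (Vec ℕ r)) t → countPartitions (lead1 A ++ lead0 B) (1 ∷ᵥ t) 0 ≡ 0
count-target1-nil []      B t = count-lead0-positive B 0 t 0
count-target1-nil (β ∷ A) B t =
  trans (+-identityʳ _) (trans (usingTimes-0 (1 ∷ᵥ β) (lead1 A ++ lead0 B) (1 ∷ᵥ t) 0) (count-target1-nil A B t))

count-target1 : ∀ {r} (A B : List (Vec ℕ r)) t k →
  countPartitions (lead1 A ++ lead0 B) (1 ∷ᵥ t) (suc k) ≡ sumℕ (map (countRest B t k) A)
count-target1 []      B t k = count-lead0-positive B 0 t (suc k)
count-target1 (β ∷ A) B t k = begin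
  countPartitions (lead1 (β ∷ A) ++ lead0 B) (1 ∷ᵥ t) (suc k)
    ≡⟨ countPartitions-cons (1 ∷ᵥ β) (lead1 A ++ lead0 B) (1 ∷ᵥ t) (suc k) ⟩
  usingTimes (1 ∷ᵥ β) C (1 ∷ᵥ t) (suc k) 0 + (usingTimes (1 ∷ᵥ β) C (1 ∷ᵥ t) (suc k) 1 + sumℕ (applyUpTo (λ m → 0) k))
    ≡⟨ cong₂ _+_ (usingTimes-0 (1 ∷ᵥ β) C (1 ∷ᵥ t) (suc k))
                 (cong₂ _+_ (trans (usingTimes-1 (1 ∷ᵥ β) C (1 ∷ᵥ t) k) (if-cong refl (count-target0 A B (subV t β) k)))
                            (sumℕ-applyUpTo-zero _ k (λ _ → refl))) ⟩
  countPartitions C (1 ∷ᵥ t) (suc k) + (countRest B t k β + 0)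
    ≡⟨ cong₂ _+_ (count-target1 A B t k) (+-identityʳ _) ⟩
  sumℕ (map (countRest B t k) A) + countRest B t k β
    ≡⟨ +-comm (sumℕ (map (countRest B t k) A)) (countRest B t k β) ⟩
  sumℕ (map (countRest B t k) (β ∷ A)) ∎
  where
  open ≡-Reasoning
  C = lead1 A ++ lead0 B

-- A target with leading coordinate 2 uses the first root β of A (with leading
-- coordinate 1) zero, one or two times.
count-target2-cons : ∀ {r} (β : Vec ℕ r) A B t k →
  countPartitions (lead1 (β ∷ A) ++ lead0 B) (2 ∷ᵥ t) k ≡
  countPartitions (lead1 A ++ lead0 B) (2 ∷ᵥ t) k
  + shift (λ j → countRest (lead1 A ++ lead0 B) (2 ∷ᵥ t) j (1 ∷ᵥ β)) k
  + shift (shift (λ j → countRest B t j (scaleV 2 β))) k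
count-target2-cons β A B t zero =
  trans (+-identityʳ _) (trans (usingTimes-0 (1 ∷ᵥ β) (lead1 A ++ lead0 B) (2 ∷ᵥ t) 0)
    (sym (trans (+-identityʳ _) (+-identityʳ _))))
count-target2-cons β A B t (suc zero) =
  trans (cong₂ _+_ (usingTimes-0 (1 ∷ᵥ β) (lead1 A ++ lead0 B) (2 ∷ᵥ t) 1)
                   (trans (+-identityʳ _) (usingTimes-1 (1 ∷ᵥ β) (lead1 A ++ lead0 B) (2 ∷ᵥ t) 0)))
    (sym (+-identityʳ _))
count-target2-cons β A B t (suc (suc k)) =
  trans (countPartitions-cons (1 ∷ᵥ β) C (2 ∷ᵥ t) (suc (suc k))) (trans (cong₂ _+_ (usingTimes-0 (1 ∷ᵥ β) C (2 ∷ᵥ t) (suc (suc k)))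
                   (cong₂ _+_ (usingTimes-1 (1 ∷ᵥ β) C (2 ∷ᵥ t) (suc k))
                              (cong₂ _+_ (if-cong refl (count-target0 A B (subV t (scaleV 2 β)) k))
                                         (sumℕ-applyUpTo-zero _ k (λ _ → refl)))))
    (trans (cong (λ z → a + (b + z)) (+-identityʳ c)) (sym (+-assoc a b c))))
  where
  C = lead1 A ++ lead0 B
  a = countPartitions C (2 ∷ᵥ t) (suc (suc k))
  b = countRest C (2 ∷ᵥ t) (suc k) (1 ∷ᵥ β)
  c = countRest B t k (scaleV 2 β)

-- Targets and roots of shape 0^z 1^o v^∞, as vectors of length r.

shape : ℕ → ℕ → ℕ → ℕ → ℕ
shape (suc z) o       v zero    = 0
shape (suc z) o       v (suc x) = shape z o v x
shape zero    (suc o) v zero    = 1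
shape zero    (suc o) v (suc x) = shape zero o v x
shape zero    zero    v x       = v

shape-ones : ∀ c v x → shape 0 c v x ≡ (if x <ᵇ c then 1 else v)
shape-ones zero    v x       = refl
shape-ones (suc c) v zero    = refl
shape-ones (suc c) v (suc x) = shape-ones c v x

vec : (r : ℕ) → (ℕ → ℕ) → Vec ℕ r
vec r f = V.tabulate (f ∘ toℕ)

vec-cong : ∀ r {f g : ℕ → ℕ} → (∀ x → f x ≡ g x) → vec r f ≡ vec r g
vec-cong r h = tabulate-cong (h ∘ toℕ)

ones : ∀ r → ℕ → Vec ℕ r
ones r c = vec r (shape 0 c 0)

onesTwos : ∀ r → ℕ → Vec ℕ r
onesTwos r d = vec r (shape 0 d 2)

rootsAt : ∀ r → ℕ → ℕ → List (Vec ℕ r)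
rootsAt r i j = (if i ≤ᵇ j then nonhooked r i j ∷ [] else [])
             ++ (if suc i ≤ᵇ j then hooked r i j ∷ [] else [])

-- The tails of α₁ + … + α_{e+2} and α₁ + … + α_{e+1} + 2α_{e+2} + … for e = d, …, d+n-1.
rootPairs : ∀ r → ℕ → ℕ → List (Vec ℕ r)
rootPairs r d zero    = []
rootPairs r d (suc n) = ones r (suc d) ∷ onesTwos r d ∷ rootPairs r (suc d) n

-- The roots of B_{r+1} with α₁-coefficient 1, with that coefficient removed.
leadingRoots : ∀ r → List (Vec ℕ r)
leadingRoots r = ones r 0 ∷ rootPairs r 0 r

oneTo-suc : ∀ r → oneTo (suc r) ≡ 1 ∷ map suc (oneTo r)
oneTo-suc r = cong (1 ∷_) (trans (map-applyUpTo suc suc r)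
  (sym (trans (cong (map suc) (map-applyUpTo id suc r)) (map-applyUpTo suc suc r))))

leadingRootPair : ∀ r e → rootsAt (suc r) 1 (suc (suc e)) ≡ lead1 (ones r (suc e) ∷ onesTwos r e ∷ [])
leadingRootPair r e = cong₂ (λ u w → (1 ∷ᵥ u) ∷ (1 ∷ᵥ w) ∷ [])
  (vec-cong r (λ x → sym (shape-ones (suc e) 0 x))) (vec-cong r (λ x → sym (shape-ones e 2 x)))

leadingRootPairs : ∀ r d n →
  concatMap (λ j → rootsAt (suc r) 1 (suc (suc j))) (applyUpTo (d +_) n) ≡ lead1 (rootPairs r d n)
leadingRootPairs r d zero    = refl
leadingRootPairs r d (suc n) = cong₂ _++_
  (trans (cong (λ e → rootsAt (suc r) 1 (suc (suc e))) (+-identityʳ d)) (leadingRootPair r d))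
  (trans (cong (concatMap (λ j → rootsAt (suc r) 1 (suc (suc j)))) (applyUpTo-cong n (+-suc d)))
         (leadingRootPairs r (suc d) n))

leadingRoots-lead1 : ∀ r → concatMap (rootsAt (suc r) 1) (1 ∷ map suc (oneTo r)) ≡ lead1 (leadingRoots r)
leadingRoots-lead1 r = cong ((1 ∷ᵥ ones r 0) ∷_) (trans (concatMap-map (rootsAt (suc r) 1) suc (oneTo r))
  (trans (concatMap-map (rootsAt (suc r) 1 ∘ suc) suc (upTo r)) (leadingRootPairs r 0 r)))

rootsAt-shift : ∀ r i j → rootsAt (suc r) (suc (suc i)) (suc j) ≡ lead0 (rootsAt r (suc i) j)
rootsAt-shift r i zero = refl
rootsAt-shift r i (suc j) with i <ᵇ suc j | i <ᵇ j
... | true  | true  = refl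
... | true  | false = refl
... | false | true  = refl
... | false | false = refl

rootsFrom : ∀ r → ℕ → List (Vec ℕ (suc r))
rootsFrom r i = concatMap (rootsAt (suc r) i) (1 ∷ map suc (oneTo r))

otherRoots-lead0 : ∀ r → concatMap (rootsFrom r) (map suc (oneTo r)) ≡ lead0 (positiveRoots r)
otherRoots-lead0 r = begin
  concatMap (rootsFrom r) (map suc (oneTo r))
    ≡⟨ concatMap-map (rootsFrom r) suc (oneTo r) ⟩
  concatMap (rootsFrom r ∘ suc) (map suc (upTo r))
    ≡⟨ concatMap-map (rootsFrom r ∘ suc) suc (upTo r) ⟩
  concatMap (λ i → rootsFrom r (suc (suc i))) (upTo r)
    ≡⟨ concatMap-cong (λ i → trans (concatMap-map (rootsAt (suc r) (suc (suc i))) suc (oneTo r))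
                                   (concatMap-cong (rootsAt-shift r i) (oneTo r))) (upTo r) ⟩
  concatMap (λ i → concatMap (lead0 ∘ rootsAt r (suc i)) (oneTo r)) (upTo r)
    ≡⟨ sym (concatMap-map (λ i → concatMap (lead0 ∘ rootsAt r i) (oneTo r)) suc (upTo r)) ⟩
  concatMap (λ i → concatMap (lead0 ∘ rootsAt r i) (oneTo r)) (oneTo r)
    ≡⟨ sym (concatMap-cong (λ i → map-concatMap (0 ∷ᵥ_) (rootsAt r i) (oneTo r)) (oneTo r)) ⟩
  concatMap (λ i → lead0 (concatMap (rootsAt r i) (oneTo r))) (oneTo r)
    ≡⟨ sym (map-concatMap (0 ∷ᵥ_) (λ i → concatMap (rootsAt r i) (oneTo r)) (oneTo r)) ⟩
  lead0 (positiveRoots r) ∎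
  where open ≡-Reasoning

positiveRoots-suc : ∀ r → positiveRoots (suc r) ≡ lead1 (leadingRoots r) ++ lead0 (positiveRoots r)
positiveRoots-suc r =
  trans (cong (λ L → concatMap (λ i → concatMap (rootsAt (suc r) i) L) L) (oneTo-suc r))
        (cong₂ _++_ (leadingRoots-lead1 r) (otherRoots-lead0 r))

subV-vec : ∀ r (g h : ℕ → ℕ) → subV (vec r g) (vec r h) ≡ vec r (λ x → g x ∸ h x)
subV-vec zero    g h = refl
subV-vec (suc r) g h = cong (g 0 ∸ h 0 ∷ᵥ_) (subV-vec r (g ∘ suc) (h ∘ suc))

scaleV-vec : ∀ r m (h : ℕ → ℕ) → scaleV m (vec r h) ≡ vec r (λ x → m * h x)
scaleV-vec zero    m h = refl
scaleV-vec (suc r) m h = cong (m * h 0 ∷ᵥ_) (scaleV-vec r m (h ∘ suc))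

≤ᵇ-true : ∀ {a b} → a ≤ b → (a ≤ᵇ b) ≡ true
≤ᵇ-true a≤b = Equivalence.to T-≡ (≤⇒≤ᵇ a≤b)

≤ᵇ-false : ∀ {a b} → b < a → (a ≤ᵇ b) ≡ false
≤ᵇ-false {a} {b} b<a with a ≤ᵇ b in eq
... | true  = ⊥-elim (<⇒≱ b<a (≤ᵇ⇒≤ a b (subst T (sym eq) tt)))
... | false = refl

leqV-vec-true : ∀ r (h g : ℕ → ℕ) → (∀ x → h x ≤ g x) → leqV (vec r h) (vec r g) ≡ true
leqV-vec-true zero    h g h≤g = refl
leqV-vec-true (suc r) h g h≤g =
  cong₂ _∧_ (≤ᵇ-true (h≤g 0)) (leqV-vec-true r (h ∘ suc) (g ∘ suc) (h≤g ∘ suc))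

leqV-vec-false : ∀ r (h g : ℕ → ℕ) x → x < r → g x < h x → leqV (vec r h) (vec r g) ≡ false
leqV-vec-false (suc r) h g zero    x<r g<h = cong (_∧ leqV (vec r (h ∘ suc)) (vec r (g ∘ suc))) (≤ᵇ-false g<h)
leqV-vec-false (suc r) h g (suc x) (s≤s x<r) g<h =
  trans (cong ((h 0 ≤ᵇ g 0) ∧_) (leqV-vec-false r (h ∘ suc) (g ∘ suc) x x<r g<h)) (∧-zeroʳ _)

-- The counting claims below show:
--   γ o     counts partitions of α_{z+1} + … + α_{z+o}               (γ o = q(1+q)^{o-1}),
--   Φ o m   counts partitions of the target 0^z 1^o 2^m,
--   Q m     = Φ 0 m counts partitions of 2α₁ + … + 2α_m in B_m,
--   S m     is the contribution of the root pairs, given in closed form by S-closed.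

_⊕_ : (ℕ → ℕ) → (ℕ → ℕ) → ℕ → ℕ
(f ⊕ g) k = f k + g k

binomialPoly : ℕ → ℕ → ℕ
binomialPoly zero    = δ
binomialPoly (suc c) = binomialPoly c ⊕ shift (binomialPoly c)

γ : ℕ → ℕ → ℕ
γ zero    = δ
γ (suc c) = shift (binomialPoly c)

binomialPoly-Σγ : ∀ c k → binomialPoly c k ≡ Σ (suc c) (λ i → γ i k)
binomialPoly-Σγ zero    k = refl
binomialPoly-Σγ (suc c) k = cong (_+ shift (binomialPoly c) k) (binomialPoly-Σγ c k)

γ-suc : ∀ c k → γ (suc (suc c)) k ≡ γ (suc c) k + shift (γ (suc c)) k
γ-suc c zero    = refl
γ-suc c (suc k) = refl

γ-telescope : ∀ n k → δ k + Σ (suc n) (λ e → γ (suc e) k) ≡ Σ (suc n) (λ e → γ e k) + Σ (suc n) (λ e → shift (γ e) k)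
γ-telescope zero    k = refl
γ-telescope (suc n) k = begin
  δ k + (Σ (suc n) (λ e → γ (suc e) k) + γ (suc (suc n)) k)
    ≡⟨ sym (+-assoc (δ k) _ _) ⟩
  δ k + Σ (suc n) (λ e → γ (suc e) k) + γ (suc (suc n)) k
    ≡⟨ cong₂ _+_ (γ-telescope n k) (γ-suc n k) ⟩
  Σ (suc n) (λ e → γ e k) + Σ (suc n) (λ e → shift (γ e) k) + (γ (suc n) k + shift (γ (suc n)) k)
    ≡⟨ interchange (Σ (suc n) (λ e → γ e k)) (Σ (suc n) (λ e → shift (γ e) k)) (γ (suc n) k) (shift (γ (suc n)) k) ⟩
  (Σ (suc n) (λ e → γ e k) + γ (suc n) k) + (Σ (suc n) (λ e → shift (γ e) k) + shift (γ (suc n)) k) ∎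
  where open ≡-Reasoning

-- The transfer matrix [[1+q², q²], [q, 1+2q]] acting on the pair (Q, S).
stepQ : (ℕ → ℕ) → (ℕ → ℕ) → ℕ → ℕ
stepQ u v = u ⊕ shift (shift (u ⊕ v))

stepS : (ℕ → ℕ) → (ℕ → ℕ) → ℕ → ℕ
stepS u v = (v ⊕ shift v) ⊕ shift (u ⊕ v)

mutual
  Q : ℕ → ℕ → ℕ
  Q zero          = δ
  Q (suc zero)    = shift (shift δ)
  Q (suc (suc m)) = stepQ (Q (suc m)) (S (suc m))

  S : ℕ → ℕ → ℕ
  S zero          = λ _ → 0
  S (suc zero)    = δ ⊕ shift δ
  S (suc (suc m)) = stepS (Q (suc m)) (S (suc m))

Φ : ℕ → ℕ → ℕ → ℕ
Φ zero          m = Q m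
Φ (suc zero)    m = shift (Q m ⊕ S m)
Φ (suc (suc a)) m = Φ (suc a) m ⊕ shift (Φ (suc a) m)

Φ-suc : ∀ a m k → Φ (suc a) m k ≡ shift (λ k → Σ (suc a) (λ i → Φ i m k) + S m k) k
Φ-suc zero    m k = refl
Φ-suc (suc a) m k = begin
  Φ (suc a) m k + shift (Φ (suc a) m) k
    ≡⟨ cong (_+ shift (Φ (suc a) m) k) (Φ-suc a m k) ⟩
  shift (λ k → Σ (suc a) (λ i → Φ i m k) + S m k) k + shift (Φ (suc a) m) k
    ≡⟨ sym (shift-+ _ _ k) ⟩
  shift (λ k → Σ (suc a) (λ i → Φ i m k) + S m k + Φ (suc a) m k) k
    ≡⟨ shift-cong (λ k → xy∙z≈xz∙y (Σ (suc a) (λ i → Φ i m k)) (S m k) (Φ (suc a) m k)) k ⟩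
  shift (λ k → Σ (suc (suc a)) (λ i → Φ i m k) + S m k) k ∎
  where open ≡-Reasoning

Q-suc : ∀ r k → Q (suc r) k ≡ shift (shift (λ k → Σ (suc r) (λ n → Q n k + S n k))) k
Q-suc zero    k = shift-cong (shift-cong (λ k → sym (+-identityʳ (δ k)))) k
Q-suc (suc r) k = begin
  Q (suc r) k + shift (shift (Q (suc r) ⊕ S (suc r))) k
    ≡⟨ cong (_+ shift (shift (Q (suc r) ⊕ S (suc r))) k) (Q-suc r k) ⟩
  shift (shift (λ k → Σ (suc r) (λ n → Q n k + S n k))) k + shift (shift (Q (suc r) ⊕ S (suc r))) k
    ≡⟨ sym (shift-+ _ _ k) ⟩
  shift (λ k → shift (λ k → Σ (suc r) (λ n → Q n k + S n k)) k + shift (Q (suc r) ⊕ S (suc r)) k) k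
    ≡⟨ shift-cong (λ k → sym (shift-+ _ _ k)) k ⟩
  shift (shift (λ k → Σ (suc (suc r)) (λ n → Q n k + S n k))) k ∎
  where open ≡-Reasoning

-- S m = Σ_{e < m} (Φ (e+1) (m-e-1) + γ e): the pair of roots α₁+…+α_{e+2} and
-- α₁+…+α_{e+1}+2α_{e+2}+… contributes Φ (e+1) (m-e-1) and γ e respectively.
S-closed : ∀ m k → S m k ≡ Σ m (λ e → Φ (suc e) (m ∸ suc e) k + γ e k)
S-closed zero          k = refl
S-closed (suc zero)    k = trans (+-comm (δ k) (shift δ k)) (cong (_+ δ k) (shift-cong (λ k → sym (+-identityʳ (δ k))) k))
S-closed (suc (suc b)) k = begin
  S n k + shift (S n) k + P
    ≡⟨ cong (λ z → S n k + z + P) (trans (shift-cong (S-closed (suc b)) k)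
         (trans (shift-Σ n (λ e k → Φ (suc e) (n ∸ suc e) k + γ e k) k)
         (trans (Σ-cong′ n (λ e → shift-+ (Φ (suc e) (n ∸ suc e)) (γ e) k)) (Σ-+ n _ _)))) ⟩
  S n k + (B + H) + P
    ≡⟨ cong (λ z → z + (B + H) + P) (trans (S-closed (suc b) k) (Σ-+ n _ _)) ⟩
  (A + G) + (B + H) + P
    ≡⟨ regroup₁ A B G H P ⟩
  (A + B) + P + (G + H)
    ≡⟨ cong ((A + B) + P +_) (sym (γ-telescope b k)) ⟩
  (A + B) + P + (δ k + Gs)
    ≡⟨ regroup₂ A B P (δ k) Gs ⟩
  P + δ k + ((A + B) + Gs)
    ≡⟨ cong (λ z → P + δ k + (z + Gs)) (sym (Σ-+ n _ _)) ⟩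
  P + δ k + (Σ n (λ e → Φ (suc e) (n ∸ suc e) k + shift (Φ (suc e) (n ∸ suc e)) k) + Gs)
    ≡⟨ cong (P + δ k +_) (sym (Σ-+ n _ _)) ⟩
  P + δ k + Σ n (λ e → Φ (suc (suc e)) (suc n ∸ suc (suc e)) k + γ (suc e) k)
    ≡⟨ sym (Σ-head n (λ e → Φ (suc e) (suc n ∸ suc e) k + γ e k)) ⟩
  Σ (suc n) (λ e → Φ (suc e) (suc n ∸ suc e) k + γ e k) ∎
  where
  open ≡-Reasoning
  n  = suc b
  P  = shift (Q n ⊕ S n) k
  A  = Σ n (λ e → Φ (suc e) (n ∸ suc e) k)
  B  = Σ n (λ e → shift (Φ (suc e) (n ∸ suc e)) k)
  G  = Σ n (λ e → γ e k)
  H  = Σ n (λ e → shift (γ e) k)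
  Gs = Σ n (λ e → γ (suc e) k)
  regroup₁ : ∀ A B G H P → (A + G) + (B + H) + P ≡ (A + B) + P + (G + H)
  regroup₁ = solve-∀
  regroup₂ : ∀ A B P d Gs → (A + B) + P + (d + Gs) ≡ P + d + ((A + B) + Gs)
  regroup₂ = solve-∀

shape-minus-ones : ∀ c i v x → shape 0 (c + i) v x ∸ shape 0 c 0 x ≡ shape c i v x
shape-minus-ones zero    i v x       = refl
shape-minus-ones (suc c) i v zero    = refl
shape-minus-ones (suc c) i v (suc x) = shape-minus-ones c i v x

two-minus-ones : ∀ n x → 2 ∸ shape 0 n 0 x ≡ shape 0 n 2 x
two-minus-ones zero    x       = refl
two-minus-ones (suc n) zero    = refl
two-minus-ones (suc n) (suc x) = two-minus-ones n x

onesTwos-minus-ones : ∀ a i x → shape 0 a 2 x ∸ shape 0 (a + suc i) 0 x ≡ shape a (suc i) 2 x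
onesTwos-minus-ones zero    i x       = two-minus-ones (suc i) x
onesTwos-minus-ones (suc a) i zero    = refl
onesTwos-minus-ones (suc a) i (suc x) = onesTwos-minus-ones a i x

two-minus-onesTwos : ∀ n x → 2 ∸ shape 0 n 2 x ≡ shape 0 n 0 x
two-minus-onesTwos zero    x       = refl
two-minus-onesTwos (suc n) zero    = refl
two-minus-onesTwos (suc n) (suc x) = two-minus-onesTwos n x

onesTwos-minus-onesTwos : ∀ a i x → shape 0 a 2 x ∸ shape 0 (a + i) 2 x ≡ shape a i 0 x
onesTwos-minus-onesTwos zero    i x       = two-minus-onesTwos i x
onesTwos-minus-onesTwos (suc a) i zero    = refl
onesTwos-minus-onesTwos (suc a) i (suc x) = onesTwos-minus-onesTwos a i x

two-minus-twice-ones : ∀ c x → 2 ∸ 2 * shape 0 c 0 x ≡ shape c 0 2 x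
two-minus-twice-ones zero    x       = refl
two-minus-twice-ones (suc c) zero    = refl
two-minus-twice-ones (suc c) (suc x) = two-minus-twice-ones c x

shape-inside : ∀ c v x → x < c → shape 0 c v x ≡ 1
shape-inside (suc c) v zero    _         = refl
shape-inside (suc c) v (suc x) (s≤s x<c) = shape-inside c v x x<c

shape-beyond : ∀ c v x → c ≤ x → shape 0 c v x ≡ v
shape-beyond zero    v x       _         = refl
shape-beyond (suc c) v (suc x) (s≤s c≤x) = shape-beyond c v x c≤x

ones-≤1 : ∀ c x → shape 0 c 0 x ≤ 1
ones-≤1 zero    x       = z≤n
ones-≤1 (suc c) zero    = ≤-refl
ones-≤1 (suc c) (suc x) = ones-≤1 c x

onesTwos-≥1 : ∀ a x → 1 ≤ shape 0 a 2 x
onesTwos-≥1 zero    x       = s≤s z≤n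
onesTwos-≥1 (suc a) zero    = ≤-refl
onesTwos-≥1 (suc a) (suc x) = onesTwos-≥1 a x

onesTwos-≤2 : ∀ d x → shape 0 d 2 x ≤ 2
onesTwos-≤2 zero    x       = ≤-refl
onesTwos-≤2 (suc d) zero    = s≤s z≤n
onesTwos-≤2 (suc d) (suc x) = onesTwos-≤2 d x

ones-mono : ∀ c i x → shape 0 c 0 x ≤ shape 0 (c + i) 0 x
ones-mono zero    i x       = z≤n
ones-mono (suc c) i zero    = ≤-refl
ones-mono (suc c) i (suc x) = ones-mono c i x

onesTwos-antimono : ∀ a i x → shape 0 (a + i) 2 x ≤ shape 0 a 2 x
onesTwos-antimono zero    i x       = onesTwos-≤2 i x
onesTwos-antimono (suc a) i zero    = ≤-refl
onesTwos-antimono (suc a) i (suc x) = onesTwos-antimono a i x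

ones≤onesTwos : ∀ c a x → shape 0 c 0 x ≤ shape 0 a 2 x
ones≤onesTwos c a x = ≤-trans (ones-≤1 c x) (onesTwos-≥1 a x)

twice-ones-≤2 : ∀ c x → 2 * shape 0 c 0 x ≤ 2
twice-ones-≤2 c x = *-monoʳ-≤ 2 (ones-≤1 c x)

count : ℕ → (ℕ → ℕ) → ℕ → ℕ
count r f k = countPartitions (positiveRoots r) (vec r f) k

count-cong : ∀ r {f g : ℕ → ℕ} → (∀ x → f x ≡ g x) → ∀ k → count r f k ≡ count r g k
count-cong r f≡g k = cong (λ v → countPartitions (positiveRoots r) v k) (vec-cong r f≡g)

count-peel : ∀ r (f : ℕ → ℕ) k → f 0 ≡ 0 → count (suc r) f k ≡ count r (f ∘ suc) k
count-peel r f k f0 =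
  trans (cong₂ (λ L z → countPartitions L (z ∷ᵥ vec r (f ∘ suc)) k) (positiveRoots-suc r) f0)
        (count-target0 (leadingRoots r) (positiveRoots r) (vec r (f ∘ suc)) k)

countAfter : ∀ r → (ℕ → ℕ) → ℕ → Vec ℕ r → ℕ
countAfter r g k = countRest (positiveRoots r) (vec r g) k

-- A leading coordinate 1 is covered by exactly one of the leadingRoots.
count-lead1-nil : ∀ r (f : ℕ → ℕ) → f 0 ≡ 1 → count (suc r) f 0 ≡ 0
count-lead1-nil r f f0 =
  trans (cong₂ (λ L z → countPartitions L (z ∷ᵥ vec r (f ∘ suc)) 0) (positiveRoots-suc r) f0)
        (count-target1-nil (leadingRoots r) (positiveRoots r) (vec r (f ∘ suc)))

count-lead1 : ∀ r (f : ℕ → ℕ) k → f 0 ≡ 1 →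
  count (suc r) f (suc k) ≡ sumℕ (map (countAfter r (f ∘ suc) k) (leadingRoots r))
count-lead1 r f k f0 =
  trans (cong₂ (λ L z → countPartitions L (z ∷ᵥ vec r (f ∘ suc)) (suc k)) (positiveRoots-suc r) f0)
        (count-target1 (leadingRoots r) (positiveRoots r) (vec r (f ∘ suc)) k)

countAfter-fits : ∀ r (g h : ℕ → ℕ) k → (∀ x → h x ≤ g x) → countAfter r g k (vec r h) ≡ count r (λ x → g x ∸ h x) k
countAfter-fits r g h k h≤g = if-cong {x′ = count r (λ x → g x ∸ h x) k} (leqV-vec-true r h g h≤g)
  (cong (λ v → countPartitions (positiveRoots r) v k) (subV-vec r g h))

countAfter-exceeds : ∀ r (g h : ℕ → ℕ) k x → x < r → g x < h x → countAfter r g k (vec r h) ≡ 0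
countAfter-exceeds r g h k x x<r g<h = if-false (leqV-vec-false r h g x x<r g<h)

pairSum : ∀ r → (Vec ℕ r → ℕ) → ℕ → ℕ
pairSum r F e = F (ones r (suc e)) + F (onesTwos r e)

sum-rootPairs : ∀ r (F : Vec ℕ r → ℕ) d n → sumℕ (map F (rootPairs r d n)) ≡ Σ n (λ i → pairSum r F (d + i))
sum-rootPairs r F d zero    = refl
sum-rootPairs r F d (suc n) = begin
  F (ones r (suc d)) + (F (onesTwos r d) + sumℕ (map F (rootPairs r (suc d) n)))
    ≡⟨ sym (+-assoc (F (ones r (suc d))) _ _) ⟩
  pairSum r F d + sumℕ (map F (rootPairs r (suc d) n))
    ≡⟨ cong₂ _+_ (cong (pairSum r F) (sym (+-identityʳ d)))
                 (trans (sum-rootPairs r F (suc d) n) (Σ-cong′ n (λ i → cong (pairSum r F) (sym (+-suc d i))))) ⟩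
  pairSum r F (d + 0) + Σ n (λ i → pairSum r F (d + suc i))
    ≡⟨ sym (Σ-head n (λ i → pairSum r F (d + i))) ⟩
  Σ (suc n) (λ i → pairSum r F (d + i)) ∎
  where open ≡-Reasoning

onesTwos-exceeds : ∀ r (g : ℕ → ℕ) k e → e < r → (∀ x → g x ≤ 1) → countAfter r g k (onesTwos r e) ≡ 0
onesTwos-exceeds r g k e e<r g≤1 =
  countAfter-exceeds r g (shape 0 e 2) k e e<r (subst (g e <_) (sym (shape-beyond e 2 e ≤-refl)) (s≤s (g≤1 e)))

-- Partitions of the targets 0^z 1^o 0^m, i.e. of α_{z+1} + … + α_{z+o}, in B_{z+o+m}.
-- The claim for rank r is the induction hypothesis for rank r + 1.

OnesCounts : ℕ → Set
OnesCounts r = ∀ z o → z + o ≤ r → ∀ k → count r (shape z o 0) k ≡ γ o k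

-- In the target 1^c 0^{r-c}, the root α₁+…+α_{e+2} leaves α_{e+3}+…+α_{c+1} when
-- e < c and does not fit otherwise; no root 1^e 2^… fits.  So the pairs give Σ_{i<c} γ i.
pairs-ones : ∀ r → OnesCounts r → ∀ c → c ≤ r → ∀ k →
  Σ r (pairSum r (countAfter r (shape 0 c 0) k)) ≡ Σ c (λ i → γ i k)
pairs-ones r IH c c≤r k = begin
  Σ r (λ e → F (ones r (suc e)) + F (onesTwos r e))
    ≡⟨ Σ-cong r (λ e e<r → trans (cong (F (ones r (suc e)) +_) (onesTwos-exceeds r (shape 0 c 0) k e e<r (ones-≤1 c)))
                                 (+-identityʳ _)) ⟩
  Σ r (λ e → F (ones r (suc e)))
    ≡⟨ cong (λ w → Σ w (λ e → F (ones r (suc e)))) (sym (m+[n∸m]≡n c≤r)) ⟩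
  Σ (c + (r ∸ c)) (λ e → F (ones r (suc e)))
    ≡⟨ Σ-split c (r ∸ c) _ ⟩
  Σ c (λ e → F (ones r (suc e))) + Σ (r ∸ c) (λ i → F (ones r (suc (c + i))))
    ≡⟨ cong₂ _+_ (Σ-cong c fitting) (Σ-zero (r ∸ c) _ tooLong) ⟩
  Σ c (λ e → γ (c ∸ suc e) k) + 0
    ≡⟨ trans (+-identityʳ _) (Σ-reverse c (λ i → γ i k)) ⟩
  Σ c (λ i → γ i k) ∎
  where
  open ≡-Reasoning
  F = countAfter r (shape 0 c 0) k
  fitting : ∀ e → e < c → F (ones r (suc e)) ≡ γ (c ∸ suc e) k
  fitting e e<c = begin
    F (ones r (suc e))
      ≡⟨ countAfter-fits r (shape 0 c 0) (shape 0 (suc e) 0) k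
           (λ x → subst (λ w → shape 0 (suc e) 0 x ≤ shape 0 w 0 x) (m+[n∸m]≡n e<c) (ones-mono (suc e) (c ∸ suc e) x)) ⟩
    count r (λ x → shape 0 c 0 x ∸ shape 0 (suc e) 0 x) k
      ≡⟨ count-cong r (λ x → trans (cong (λ w → shape 0 w 0 x ∸ shape 0 (suc e) 0 x) (sym (m+[n∸m]≡n e<c)))
                                   (shape-minus-ones (suc e) (c ∸ suc e) 0 x)) k ⟩
    count r (shape (suc e) (c ∸ suc e) 0) k
      ≡⟨ IH (suc e) (c ∸ suc e) (subst (_≤ r) (sym (m+[n∸m]≡n e<c)) c≤r) k ⟩
    γ (c ∸ suc e) k ∎
  tooLong : ∀ i → i < r ∸ c → F (ones r (suc (c + i))) ≡ 0
  tooLong i i<r-c = countAfter-exceeds r (shape 0 c 0) (shape 0 (suc (c + i)) 0) k c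
    (subst (c <_) (m+[n∸m]≡n c≤r) (m<m+n c (≤-<-trans z≤n i<r-c)))
    (subst₂ _<_ (sym (shape-beyond c 0 c ≤-refl)) (sym (shape-inside (suc (c + i)) 0 c (s≤s (m≤m+n c i)))) (s≤s z≤n))

-- A leading 1 is covered either by α₁, leaving 1^c (γ c), or by one of the pairs.
count-ones : ∀ r → OnesCounts r
count-ones zero    zero    zero    _           k       = refl
count-ones (suc r) (suc z) o       (s≤s z+o≤r) k       = trans (count-peel r (shape (suc z) o 0) k refl) (count-ones r z o z+o≤r k)
count-ones (suc r) zero    zero    _           k       = trans (count-peel r (shape 0 0 0) k refl) (count-ones r zero zero z≤n k)
count-ones (suc r) zero    (suc c) (s≤s c≤r)   zero    = count-lead1-nil r (shape 0 (suc c) 0) refl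
count-ones (suc r) zero    (suc c) (s≤s c≤r)   (suc k) = begin
  count (suc r) (shape 0 (suc c) 0) (suc k)
    ≡⟨ count-lead1 r (shape 0 (suc c) 0) k refl ⟩
  F (ones r 0) + sumℕ (map F (rootPairs r 0 r))
    ≡⟨ cong₂ _+_ (trans (countAfter-fits r (shape 0 c 0) (shape 0 0 0) k (λ _ → z≤n)) (count-ones r zero c c≤r k))
                 (trans (sum-rootPairs r F 0 r) (pairs-ones r (count-ones r) c c≤r k)) ⟩
  γ c k + Σ c (λ i → γ i k)
    ≡⟨ trans (+-comm (γ c k) _) (sym (binomialPoly-Σγ c k)) ⟩
  γ (suc c) (suc k) ∎
  where
  open ≡-Reasoning
  F = countAfter r (shape 0 c 0) k

-- Partitions of the targets 0^z 1^o 2^m in B_{z+o+m}.  The claim for rank r is the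
-- induction hypothesis for rank r + 1.

OnesTwosCounts : ℕ → Set
OnesTwosCounts r = ∀ z o → z + o ≤ r → ∀ k → count r (shape z o 2) k ≡ Φ o (r ∸ (z + o)) k

-- In the target 1^d 2^n, the root pair at offset d + i leaves 0^d 1^{i+1} 2^{n-i-1}
-- resp. 0^d 1^i 0^{n-i}.
pairSum-onesTwos : ∀ r → OnesTwosCounts r → ∀ d n i → i < n → d + n ≡ r → ∀ k →
  pairSum r (countAfter r (shape 0 d 2) k) (d + i) ≡ Φ (suc i) (n ∸ suc i) k + γ i k
pairSum-onesTwos r IH d n i i<n d+n≡r k = cong₂ _+_ viaOnes viaOnesTwos
  where
  open ≡-Reasoning
  bound : d + suc i ≤ r
  bound = subst (d + suc i ≤_) d+n≡r (+-monoʳ-≤ d i<n)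
  viaOnes : countAfter r (shape 0 d 2) k (ones r (suc (d + i))) ≡ Φ (suc i) (n ∸ suc i) k
  viaOnes = begin
    countAfter r (shape 0 d 2) k (ones r (suc (d + i)))
      ≡⟨ countAfter-fits r (shape 0 d 2) (shape 0 (suc (d + i)) 0) k (λ x → ones≤onesTwos (suc (d + i)) d x) ⟩
    count r (λ x → shape 0 d 2 x ∸ shape 0 (suc (d + i)) 0 x) k
      ≡⟨ count-cong r (λ x → trans (cong (λ w → shape 0 d 2 x ∸ shape 0 w 0 x) (sym (+-suc d i)))
                                   (onesTwos-minus-ones d i x)) k ⟩
    count r (shape d (suc i) 2) k
      ≡⟨ IH d (suc i) bound k ⟩
    Φ (suc i) (r ∸ (d + suc i)) k
      ≡⟨ cong (λ w → Φ (suc i) w k) (trans (cong (_∸ (d + suc i)) (sym d+n≡r)) ([m+n]∸[m+o]≡n∸o d n (suc i))) ⟩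
    Φ (suc i) (n ∸ suc i) k ∎
  viaOnesTwos : countAfter r (shape 0 d 2) k (onesTwos r (d + i)) ≡ γ i k
  viaOnesTwos = begin
    countAfter r (shape 0 d 2) k (onesTwos r (d + i))
      ≡⟨ countAfter-fits r (shape 0 d 2) (shape 0 (d + i) 2) k (onesTwos-antimono d i) ⟩
    count r (λ x → shape 0 d 2 x ∸ shape 0 (d + i) 2 x) k
      ≡⟨ count-cong r (onesTwos-minus-onesTwos d i) k ⟩
    count r (shape d i 0) k
      ≡⟨ count-ones r d i (≤-trans (+-monoʳ-≤ d (n≤1+n i)) bound) k ⟩
    γ i k ∎

pairs-onesTwos : ∀ r → OnesTwosCounts r → ∀ d n → d + n ≡ r → ∀ k →
  sumℕ (map (countAfter r (shape 0 d 2) k) (rootPairs r d n)) ≡ S n k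
pairs-onesTwos r IH d n d+n≡r k =
  trans (sum-rootPairs r _ d n)
        (trans (Σ-cong n (λ i i<n → pairSum-onesTwos r IH d n i i<n d+n≡r k)) (sym (S-closed n k)))

-- In the target 1^a 2^m (a + m = r), the pair at offset e < a leaves 0^{e+1} 1^{a-e-1} 2^m
-- through α₁+…+α_{e+2}, while 1^e 2^… does not fit.
pairSum-inside : ∀ r → OnesTwosCounts r → ∀ a → a ≤ r → ∀ k e → e < a →
  pairSum r (countAfter r (shape 0 a 2) k) e ≡ Φ (a ∸ suc e) (r ∸ a) k
pairSum-inside r IH a a≤r k e e<a = trans (cong₂ _+_ viaOnes viaOnesTwos) (+-identityʳ _)
  where
  open ≡-Reasoning
  split : suc e + (a ∸ suc e) ≡ a
  split = m+[n∸m]≡n e<a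
  viaOnes : countAfter r (shape 0 a 2) k (ones r (suc e)) ≡ Φ (a ∸ suc e) (r ∸ a) k
  viaOnes = begin
    countAfter r (shape 0 a 2) k (ones r (suc e))
      ≡⟨ countAfter-fits r (shape 0 a 2) (shape 0 (suc e) 0) k (λ x → ones≤onesTwos (suc e) a x) ⟩
    count r (λ x → shape 0 a 2 x ∸ shape 0 (suc e) 0 x) k
      ≡⟨ count-cong r (λ x → trans (cong (λ w → shape 0 w 2 x ∸ shape 0 (suc e) 0 x) (sym split))
                                   (shape-minus-ones (suc e) (a ∸ suc e) 2 x)) k ⟩
    count r (shape (suc e) (a ∸ suc e) 2) k
      ≡⟨ IH (suc e) (a ∸ suc e) (subst (_≤ r) (sym split) a≤r) k ⟩
    Φ (a ∸ suc e) (r ∸ (suc e + (a ∸ suc e))) k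
      ≡⟨ cong (λ w → Φ (a ∸ suc e) (r ∸ w) k) split ⟩
    Φ (a ∸ suc e) (r ∸ a) k ∎
  viaOnesTwos : countAfter r (shape 0 a 2) k (onesTwos r e) ≡ 0
  viaOnesTwos = countAfter-exceeds r (shape 0 a 2) (shape 0 e 2) k e (<-≤-trans e<a a≤r)
    (subst₂ _<_ (sym (shape-inside a 2 e e<a)) (sym (shape-beyond e 2 e ≤-refl)) ≤-refl)

-- All leading roots in the target 1^a 2^{r-a}: α₁ leaves 1^a 2^{r-a}, the pairs at
-- offsets e < a are given by pairSum-inside, and the rest give S (r-a).
leadingRoots-onesTwos : ∀ r → OnesTwosCounts r → ∀ a → a ≤ r → ∀ k →
  sumℕ (map (countAfter r (shape 0 a 2) k) (leadingRoots r)) ≡ Φ (suc a) (r ∸ a) (suc k)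
leadingRoots-onesTwos r IH a a≤r k = begin
  F (ones r 0) + sumℕ (map F (rootPairs r 0 r))
    ≡⟨ cong₂ _+_ (trans (countAfter-fits r (shape 0 a 2) (shape 0 0 0) k (ones≤onesTwos 0 a)) (IH 0 a a≤r k))
                 (sum-rootPairs r F 0 r) ⟩
  Φ a m k + Σ r (pairSum r F)
    ≡⟨ cong (λ w → Φ a m k + Σ w (pairSum r F)) (sym a+m≡r) ⟩
  Φ a m k + Σ (a + m) (pairSum r F)
    ≡⟨ cong (Φ a m k +_) (Σ-split a m (pairSum r F)) ⟩
  Φ a m k + (Σ a (pairSum r F) + Σ m (λ i → pairSum r F (a + i)))
    ≡⟨ cong₂ (λ u w → Φ a m k + (u + w))
         (trans (Σ-cong a (pairSum-inside r IH a a≤r k)) (Σ-reverse a (λ i → Φ i m k)))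
         (trans (Σ-cong m (λ i i<m → pairSum-onesTwos r IH a m i i<m a+m≡r k)) (sym (S-closed m k))) ⟩
  Φ a m k + (Σ a (λ i → Φ i m k) + S m k)
    ≡⟨ trans (sym (+-assoc (Φ a m k) _ _)) (cong (_+ S m k) (+-comm (Φ a m k) _)) ⟩
  Σ (suc a) (λ i → Φ i m k) + S m k
    ≡⟨ sym (Φ-suc a m (suc k)) ⟩
  Φ (suc a) m (suc k) ∎
  where
  open ≡-Reasoning
  F = countAfter r (shape 0 a 2) k
  m = r ∸ a
  a+m≡r : a + m ≡ r
  a+m≡r = m+[n∸m]≡n a≤r

-- Its leading 2 is covered by two of the
-- leadingRoots (or one of them twice); running through the list with
-- count-target2-cons, each root pair contributes W below.

twos : ∀ r → Vec ℕ r
twos r = vec r (shape 0 0 2)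

W : ℕ → ℕ → ℕ
W m = shift (shift (Q m ⊕ S m))

W-split : ∀ m k → W m k ≡ shift (shift (Q m)) k + shift (shift (S m)) k
W-split m k = trans (shift-cong (shift-+ (Q m) (S m)) k) (shift-+ _ _ k)

Σ-W : ∀ m k → Σ m (λ i → W i k) ≡ shift (shift (λ k → Σ m (λ n → Q n k + S n k))) k
Σ-W m k = trans (sym (shift-Σ m (λ i → shift (Q i ⊕ S i)) k))
                (shift-cong (λ k → sym (shift-Σ m (λ i → Q i ⊕ S i) k)) k)

-- Using α₁+…+α_{d+2} once leaves 1 1^{d+1} 2^n, of which the pairs make q S n.
once-ones : ∀ r → OnesTwosCounts r → ∀ d n → suc d + n ≡ r → ∀ j →
  countRest (lead1 (onesTwos r d ∷ rootPairs r (suc d) n) ++ lead0 (positiveRoots r)) (2 ∷ᵥ twos r) j (1 ∷ᵥ ones r (suc d))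
  ≡ shift (S n) j
once-ones r IH d n eq j =
  trans (if-true (leqV-vec-true r (shape 0 (suc d) 0) (shape 0 0 2) (ones≤onesTwos (suc d) 0)))
        (trans (cong (λ v → countPartitions C (1 ∷ᵥ v) j) rest) (afterwards j))
  where
  C = lead1 (onesTwos r d ∷ rootPairs r (suc d) n) ++ lead0 (positiveRoots r)
  rest : subV (twos r) (ones r (suc d)) ≡ vec r (shape 0 (suc d) 2)
  rest = trans (subV-vec r (shape 0 0 2) (shape 0 (suc d) 0)) (vec-cong r (two-minus-ones (suc d)))
  d<r : d < r
  d<r = subst (d <_) eq (s≤s (m≤m+n d n))
  afterwards : ∀ j → countPartitions C (1 ∷ᵥ vec r (shape 0 (suc d) 2)) j ≡ shift (S n) j
  afterwards zero    = count-target1-nil (onesTwos r d ∷ rootPairs r (suc d) n) (positiveRoots r) _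
  afterwards (suc j) = trans (count-target1 (onesTwos r d ∷ rootPairs r (suc d) n) (positiveRoots r) _ j)
    (cong₂ _+_ (countAfter-exceeds r (shape 0 (suc d) 2) (shape 0 d 2) j d d<r
                 (subst₂ _<_ (sym (shape-inside (suc d) 2 d ≤-refl)) (sym (shape-beyond d 2 d ≤-refl)) ≤-refl))
               (pairs-onesTwos r IH (suc d) n eq j))

-- Using α₁+…+α_{d+2} twice leaves 0^{d+1} 2^n, counted by Q n.
twice-ones : ∀ r → OnesTwosCounts r → ∀ d n → suc d + n ≡ r → ∀ j →
  countRest (positiveRoots r) (twos r) j (scaleV 2 (ones r (suc d))) ≡ Q n j
twice-ones r IH d n eq j = begin
  countRest (positiveRoots r) (twos r) j (scaleV 2 (ones r (suc d)))
    ≡⟨ cong (countAfter r (shape 0 0 2) j) (scaleV-vec r 2 (shape 0 (suc d) 0)) ⟩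
  countAfter r (shape 0 0 2) j (vec r (λ x → 2 * shape 0 (suc d) 0 x))
    ≡⟨ countAfter-fits r (shape 0 0 2) (λ x → 2 * shape 0 (suc d) 0 x) j (twice-ones-≤2 (suc d)) ⟩
  count r (λ x → 2 ∸ 2 * shape 0 (suc d) 0 x) j
    ≡⟨ count-cong r (two-minus-twice-ones (suc d)) j ⟩
  count r (shape (suc d) 0 2) j
    ≡⟨ IH (suc d) 0 (subst (_≤ r) (sym (+-identityʳ (suc d))) (subst (suc d ≤_) eq (m≤m+n (suc d) n))) j ⟩
  Q (r ∸ (suc d + 0)) j
    ≡⟨ cong (λ w → Q w j) (trans (cong (r ∸_) (+-identityʳ (suc d))) (trans (cong (_∸ suc d) (sym eq)) (m+n∸m≡n (suc d) n))) ⟩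
  Q n j ∎
  where open ≡-Reasoning

-- Using α₁+…+α_{d+1}+2α_{d+2}+… once leaves 1 1^d 0^{n+1}, which no later pair fits.
once-onesTwos : ∀ r d n → suc d + n ≡ r → ∀ j →
  countRest (lead1 (rootPairs r (suc d) n) ++ lead0 (positiveRoots r)) (2 ∷ᵥ twos r) j (1 ∷ᵥ onesTwos r d) ≡ 0
once-onesTwos r d n eq j =
  trans (if-true (leqV-vec-true r (shape 0 d 2) (shape 0 0 2) (onesTwos-≤2 d)))
        (trans (cong (λ v → countPartitions (lead1 (rootPairs r (suc d) n) ++ lead0 (positiveRoots r)) (1 ∷ᵥ v) j) rest)
               (afterwards j))
  where
  rest : subV (twos r) (onesTwos r d) ≡ vec r (shape 0 d 0)
  rest = trans (subV-vec r (shape 0 0 2) (shape 0 d 2)) (vec-cong r (two-minus-onesTwos d))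
  d<r : d < r
  d<r = subst (d <_) eq (s≤s (m≤m+n d n))
  F : ℕ → Vec ℕ r → ℕ
  F j = countAfter r (shape 0 d 0) j
  noPair : ∀ j i → i < n → pairSum r (F j) (suc d + i) ≡ 0
  noPair j i i<n = cong₂ _+_
    (countAfter-exceeds r (shape 0 d 0) (shape 0 (suc (suc d + i)) 0) j d d<r
      (subst₂ _<_ (sym (shape-beyond d 0 d ≤-refl))
                  (sym (shape-inside (suc (suc d + i)) 0 d (s≤s (≤-trans (n≤1+n d) (m≤m+n (suc d) i))))) (s≤s z≤n)))
    (onesTwos-exceeds r (shape 0 d 0) j (suc d + i) (subst (suc d + i <_) eq (+-monoʳ-< (suc d) i<n)) (ones-≤1 d))
  afterwards : ∀ j → countPartitions (lead1 (rootPairs r (suc d) n) ++ lead0 (positiveRoots r)) (1 ∷ᵥ vec r (shape 0 d 0)) j ≡ 0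
  afterwards zero    = count-target1-nil (rootPairs r (suc d) n) (positiveRoots r) _
  afterwards (suc j) = trans (count-target1 (rootPairs r (suc d) n) (positiveRoots r) _ j)
    (trans (sum-rootPairs r (F j) (suc d) n) (Σ-zero n _ (noPair j)))

-- Using α₁+…+α_{d+1}+2α_{d+2}+… twice exceeds the coordinate 2 at α_{d+2}.
twice-onesTwos : ∀ r d → d < r → ∀ j → countRest (positiveRoots r) (twos r) j (scaleV 2 (onesTwos r d)) ≡ 0
twice-onesTwos r d d<r j = trans (cong (countAfter r (shape 0 0 2) j) (scaleV-vec r 2 (shape 0 d 2)))
  (countAfter-exceeds r (shape 0 0 2) (λ x → 2 * shape 0 d 2 x) j d d<r
    (subst (2 <_) (sym (cong (2 *_) (shape-beyond d 2 d ≤-refl))) (s≤s (s≤s (s≤s z≤n)))))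

pairs-twos : ∀ r → OnesTwosCounts r → ∀ d n → d + n ≡ r → ∀ k →
  countPartitions (lead1 (rootPairs r d n) ++ lead0 (positiveRoots r)) (2 ∷ᵥ twos r) k ≡ Σ n (λ i → W (n ∸ suc i) k)
pairs-twos r IH d zero    eq k = count-lead0-positive (positiveRoots r) 1 (twos r) k
pairs-twos r IH d (suc n) eq k = begin
  countPartitions (lead1 (N ∷ H ∷ B′) ++ PR) (2 ∷ᵥ twos r) k
    ≡⟨ count-target2-cons N (H ∷ B′) (positiveRoots r) (twos r) k ⟩
  countPartitions (lead1 (H ∷ B′) ++ PR) (2 ∷ᵥ twos r) k + shift onceN k + shift (shift twiceN) k
    ≡⟨ cong₂ _+_ (cong₂ _+_ (count-target2-cons H B′ (positiveRoots r) (twos r) k)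
                            (shift-cong (once-ones r IH d n eq′) k))
                 (shift-cong (shift-cong (twice-ones r IH d n eq′)) k) ⟩
  countPartitions (lead1 B′ ++ PR) (2 ∷ᵥ twos r) k + shift onceH k + shift (shift twiceH) k
    + shift (shift (S n)) k + shift (shift (Q n)) k
    ≡⟨ cong (λ w → w + shift (shift (S n)) k + shift (shift (Q n)) k)
         (cong₂ _+_ (cong₂ _+_ (pairs-twos r IH (suc d) n eq′ k) (shift-zero onceH (once-onesTwos r d n eq′) k))
                    (shift-zero _ (shift-zero twiceH (twice-onesTwos r d d<r)) k)) ⟩
  Σ n (λ i → W (n ∸ suc i) k) + 0 + 0 + shift (shift (S n)) k + shift (shift (Q n)) k
    ≡⟨ regroup (Σ n (λ i → W (n ∸ suc i) k)) (shift (shift (S n)) k) (shift (shift (Q n)) k) ⟩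
  shift (shift (Q n)) k + shift (shift (S n)) k + Σ n (λ i → W (n ∸ suc i) k)
    ≡⟨ cong (_+ Σ n (λ i → W (n ∸ suc i) k)) (sym (W-split n k)) ⟩
  W n k + Σ n (λ i → W (n ∸ suc i) k)
    ≡⟨ sym (Σ-head n (λ i → W (suc n ∸ suc i) k)) ⟩
  Σ (suc n) (λ i → W (suc n ∸ suc i) k) ∎
  where
  open ≡-Reasoning
  N  = ones r (suc d)
  H  = onesTwos r d
  B′ = rootPairs r (suc d) n
  PR = lead0 (positiveRoots r)
  onceN : ℕ → ℕ
  onceN j = countRest (lead1 (H ∷ B′) ++ PR) (2 ∷ᵥ twos r) j (1 ∷ᵥ N)
  twiceN : ℕ → ℕ
  twiceN j = countRest (positiveRoots r) (twos r) j (scaleV 2 N)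
  onceH : ℕ → ℕ
  onceH j = countRest (lead1 B′ ++ PR) (2 ∷ᵥ twos r) j (1 ∷ᵥ H)
  twiceH : ℕ → ℕ
  twiceH j = countRest (positiveRoots r) (twos r) j (scaleV 2 H)
  eq′ : suc d + n ≡ r
  eq′ = trans (sym (+-suc d n)) eq
  d<r : d < r
  d<r = subst (d <_) eq′ (s≤s (m≤m+n d n))
  regroup : ∀ x s q → x + 0 + 0 + s + q ≡ q + s + x
  regroup = solve-∀

-- Partitions of 2α₁ + … + 2α_{r+1}: α₁ used twice leaves 2^r (Q r), once leaves
-- 1 2^r (q S r), and the pairs contribute Σ_{i<r} W i.
count-twos : ∀ r → OnesTwosCounts r → ∀ k → count (suc r) (shape 0 0 2) k ≡ Q (suc r) k
count-twos r IH k = begin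
  count (suc r) (shape 0 0 2) k
    ≡⟨ cong (λ L → countPartitions L (2 ∷ᵥ twos r) k) (positiveRoots-suc r) ⟩
  countPartitions (lead1 (ones r 0 ∷ rootPairs r 0 r) ++ lead0 (positiveRoots r)) (2 ∷ᵥ twos r) k
    ≡⟨ count-target2-cons (ones r 0) (rootPairs r 0 r) (positiveRoots r) (twos r) k ⟩
  countPartitions C (2 ∷ᵥ twos r) k + shift once k + shift (shift twice) k
    ≡⟨ cong₂ _+_ (cong₂ _+_ (pairs-twos r IH 0 r refl k) (shift-cong onceα₁ k)) (shift-cong (shift-cong twiceα₁) k) ⟩
  Σ r (λ i → W (r ∸ suc i) k) + shift (shift (S r)) k + shift (shift (Q r)) k
    ≡⟨ trans (+-assoc (Σ r (λ i → W (r ∸ suc i) k)) _ _)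
             (cong (Σ r (λ i → W (r ∸ suc i) k) +_) (trans (+-comm (shift (shift (S r)) k) _) (sym (W-split r k)))) ⟩
  Σ r (λ i → W (r ∸ suc i) k) + W r k
    ≡⟨ cong (_+ W r k) (Σ-reverse r (λ i → W i k)) ⟩
  Σ (suc r) (λ i → W i k)
    ≡⟨ Σ-W (suc r) k ⟩
  shift (shift (λ k → Σ (suc r) (λ n → Q n k + S n k))) k
    ≡⟨ sym (Q-suc r k) ⟩
  Q (suc r) k ∎
  where
  open ≡-Reasoning
  C = lead1 (rootPairs r 0 r) ++ lead0 (positiveRoots r)
  once : ℕ → ℕ
  once j = countRest C (2 ∷ᵥ twos r) j (1 ∷ᵥ ones r 0)
  twice : ℕ → ℕ
  twice j = countRest (positiveRoots r) (twos r) j (scaleV 2 (ones r 0))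
  afterwards : ∀ j → countPartitions C (1 ∷ᵥ twos r) j ≡ shift (S r) j
  afterwards zero    = count-target1-nil (rootPairs r 0 r) (positiveRoots r) (twos r)
  afterwards (suc j) = trans (count-target1 (rootPairs r 0 r) (positiveRoots r) (twos r) j) (pairs-onesTwos r IH 0 r refl j)
  onceα₁ : ∀ j → once j ≡ shift (S r) j
  onceα₁ j = trans (if-true (leqV-vec-true r (shape 0 0 0) (shape 0 0 2) (λ _ → z≤n)))
    (trans (cong (λ v → countPartitions C (1 ∷ᵥ v) j) (subV-vec r (shape 0 0 2) (shape 0 0 0))) (afterwards j))
  twiceα₁ : ∀ j → twice j ≡ Q r j
  twiceα₁ j = trans (cong (countAfter r (shape 0 0 2) j) (scaleV-vec r 2 (shape 0 0 0)))
    (trans (countAfter-fits r (shape 0 0 2) (λ x → 2 * shape 0 0 0 x) j (twice-ones-≤2 0)) (IH 0 0 z≤n j))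

count-onesTwos : ∀ r → OnesTwosCounts r
count-onesTwos zero    zero    zero    _           k       = refl
count-onesTwos (suc r) (suc z) o       (s≤s z+o≤r) k       =
  trans (count-peel r (shape (suc z) o 2) k refl) (count-onesTwos r z o z+o≤r k)
count-onesTwos (suc r) zero    (suc a) (s≤s a≤r)   zero    =
  trans (count-lead1-nil r (shape 0 (suc a) 2) refl) (sym (Φ-suc a (r ∸ a) 0))
count-onesTwos (suc r) zero    (suc a) (s≤s a≤r)   (suc k) =
  trans (count-lead1 r (shape 0 (suc a) 2) k refl) (leadingRoots-onesTwos r (count-onesTwos r) a a≤r k)
count-onesTwos (suc r) zero    zero    _           k       = count-twos r (count-onesTwos r) k

-- The partition function itself: the highest root has shape 1 2^b in B_{b+1}, so
-- P_{B_{b+1}} = Φ 1 b = q (Q b + S b).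

kostant : ℕ → ℕ → ℕ
kostant zero    = λ _ → 0
kostant (suc b) = shift (Q b ⊕ S b)

highestRoot-shape : ∀ r → highestRoot r ≡ vec r (shape 0 1 2)
highestRoot-shape r = vec-cong r coordinate
  where
  coordinate : ∀ x → (if x ≡ᵇ 0 then 1 else 2) ≡ shape 0 1 2 x
  coordinate zero    = refl
  coordinate (suc x) = refl

partitionsB-kostant : ∀ b k → partitionsB (suc b) k ≡ kostant (suc b) k
partitionsB-kostant b k =
  trans (cong (λ v → countPartitions (positiveRoots (suc b)) v k) (highestRoot-shape (suc b)))
        (count-onesTwos (suc b) 0 1 (s≤s z≤n) k)

-- Cayley–Hamilton for the transfer matrix M, read through E = Q + S, at one
-- coefficient; the variables are the five coefficients of u and v that occur.
cayleyHamilton-coefficient : ∀ u0 u1 u2 u3 u4 v0 v1 v2 v3 v4 →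
  (((((((u4 + (u2 + v2)) + ((u2 + (u0 + v0)) + ((v2 + v1) + (u1 + v1))))
    + ((((v4 + v3) + (u3 + v3)) + ((v3 + v2) + (u2 + v2))) + ((u3 + (u1 + v1)) + ((v3 + v2) + (u2 + v2)))))
    + (u4 + v4)) + 2 * (u3 + v3)) + (u2 + v2)) + (u1 + v1))
  ≡ ((2 * ((u4 + (u2 + v2)) + ((v4 + v3) + (u3 + v3))) + 2 * ((u3 + (u1 + v1)) + ((v3 + v2) + (u2 + v2))))
    + ((u2 + (u0 + v0)) + ((v2 + v1) + (u1 + v1))))
cayleyHamilton-coefficient = solve-∀

cayleyHamilton : ∀ (u v : ℕ → ℕ) k →
  (stepQ (stepQ u v) (stepS u v) ⊕ stepS (stepQ u v) (stepS u v)) k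
    + (u ⊕ v) k + 2 * shift (u ⊕ v) k + shift (shift (u ⊕ v)) k + shift (shift (shift (u ⊕ v))) k
  ≡ 2 * (stepQ u v ⊕ stepS u v) k + 2 * shift (stepQ u v ⊕ stepS u v) k + shift (shift (stepQ u v ⊕ stepS u v)) k
cayleyHamilton u v zero                      = cayleyHamilton-coefficient 0 0 0 0 (u 0) 0 0 0 0 (v 0)
cayleyHamilton u v (suc zero)                = cayleyHamilton-coefficient 0 0 0 (u 0) (u 1) 0 0 0 (v 0) (v 1)
cayleyHamilton u v (suc (suc zero))          = cayleyHamilton-coefficient 0 0 (u 0) (u 1) (u 2) 0 0 (v 0) (v 1) (v 2)
cayleyHamilton u v (suc (suc (suc zero)))    = cayleyHamilton-coefficient 0 (u 0) (u 1) (u 2) (u 3) 0 (v 0) (v 1) (v 2) (v 3)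
cayleyHamilton u v (suc (suc (suc (suc k)))) =
  cayleyHamilton-coefficient (u k) (u (suc k)) (u (suc (suc k))) (u (suc (suc (suc k)))) (u (suc (suc (suc (suc k)))))
    (v k) (v (suc k)) (v (suc (suc k))) (v (suc (suc (suc k)))) (v (suc (suc (suc (suc k)))))

Σℤ : ℕ → (ℕ → ℤ) → ℤ
Σℤ zero    f = ℤ.+ 0
Σℤ (suc n) f = Σℤ n f +ℤ f n

Σℤ-head : ∀ n (f : ℕ → ℤ) → Σℤ (suc n) f ≡ f 0 +ℤ Σℤ n (f ∘ suc)
Σℤ-head zero    f = trans (ℤₚ.+-identityˡ (f 0)) (sym (ℤₚ.+-identityʳ (f 0)))
Σℤ-head (suc n) f = trans (cong (_+ℤ f (suc n)) (Σℤ-head n f)) (ℤₚ.+-assoc (f 0) _ _)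

sumℤ-applyUpTo : ∀ (f : ℕ → ℤ) n → sumℤ (applyUpTo f n) ≡ Σℤ n f
sumℤ-applyUpTo f zero    = refl
sumℤ-applyUpTo f (suc n) = trans (cong (f 0 +ℤ_) (sumℤ-applyUpTo (f ∘ suc) n)) (sym (Σℤ-head n f))

Σℤ-cong : ∀ n {f g : ℕ → ℤ} → (∀ i → i < n → f i ≡ g i) → Σℤ n f ≡ Σℤ n g
Σℤ-cong zero    h = refl
Σℤ-cong (suc n) h = cong₂ _+ℤ_ (Σℤ-cong n (λ i i<n → h i (m≤n⇒m≤1+n i<n))) (h n ≤-refl)

Σℤ-zero : ∀ n (f : ℕ → ℤ) → (∀ i → i < n → f i ≡ ℤ.+ 0) → Σℤ n f ≡ ℤ.+ 0
Σℤ-zero zero    f h = refl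
Σℤ-zero (suc n) f h = cong₂ _+ℤ_ (Σℤ-zero n f (λ i i<n → h i (m≤n⇒m≤1+n i<n))) (h n ≤-refl)

poly-product : ∀ (p r : Poly) k → (p *ₚ r) k ≡ Σℤ (suc k) (λ i → p i *ℤ r (k ∸ i))
poly-product p r k = trans (cong sumℤ (map-upTo (λ i → p i *ℤ r (k ∸ i)) (suc k))) (sumℤ-applyUpTo _ (suc k))

sumP-at : ∀ (L : List Poly) k → sumP L k ≡ sumℤ (map (λ p → p k) L)
sumP-at []      k = refl
sumP-at (p ∷ L) k = cong (p k +ℤ_) (sumP-at L k)

series-product : ∀ (f g : Series) n k → (f *ₛ g) n k ≡ Σℤ (suc n) (λ i → (f i *ₚ g (n ∸ i)) k)
series-product f g n k = begin
  sumP (map F (upTo (suc n))) k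
    ≡⟨ sumP-at (map F (upTo (suc n))) k ⟩
  sumℤ (map (λ p → p k) (map F (upTo (suc n))))
    ≡⟨ cong (λ L → sumℤ (map (λ p → p k) L)) (map-upTo F (suc n)) ⟩
  sumℤ (map (λ p → p k) (applyUpTo F (suc n)))
    ≡⟨ cong sumℤ (map-applyUpTo F (λ p → p k) (suc n)) ⟩
  sumℤ (applyUpTo (λ i → F i k) (suc n))
    ≡⟨ sumℤ-applyUpTo (λ i → F i k) (suc n) ⟩
  Σℤ (suc n) (λ i → F i k) ∎
  where
  open ≡-Reasoning
  F : ℕ → Poly
  F i = f i *ₚ g (n ∸ i)

-- Multiplication by the polynomial c₀ + c₁ q + … given by its coefficient list,
-- by recursion on the list (so it reduces on symbolic coefficient indices).
timesList : Poly → List ℤ → ℕ → ℤ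
timesList p []                k       = ℤ.+ 0
timesList p (c ∷ [])          k       = p k *ℤ c
timesList p (c ∷ c′ ∷ cs)     zero    = p 0 *ℤ c
timesList p (c ∷ c′ ∷ cs)     (suc k) = timesList p (c′ ∷ cs) k +ℤ p (suc k) *ℤ c

times-nil : ∀ p k → (p *ₚ poly []) k ≡ ℤ.+ 0
times-nil p k = trans (poly-product p (poly []) k) (Σℤ-zero (suc k) _ (λ i _ → ℤₚ.*-zeroʳ (p i)))

times-cons : ∀ p c cs k → (p *ₚ poly (c ∷ cs)) (suc k) ≡ (p *ₚ poly cs) k +ℤ p (suc k) *ℤ c
times-cons p c cs k = trans (poly-product p (poly (c ∷ cs)) (suc k))
  (cong₂ _+ℤ_ (trans (Σℤ-cong (suc k) (λ i i≤k → cong (λ w → p i *ℤ poly (c ∷ cs) w) (+-∸-assoc 1 (≤-pred i≤k))))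
                     (sym (poly-product p (poly cs) k)))
              (cong (λ w → p (suc k) *ℤ poly (c ∷ cs) w) (n∸n≡0 k)))

times-poly : ∀ p cs k → (p *ₚ poly cs) k ≡ timesList p cs k
times-poly p []            k       = times-nil p k
times-poly p (c ∷ [])      zero    = ℤₚ.+-identityʳ _
times-poly p (c ∷ [])      (suc k) = trans (times-cons p c [] k) (trans (cong (_+ℤ p (suc k) *ℤ c) (times-nil p k)) (ℤₚ.+-identityˡ _))
times-poly p (c ∷ c′ ∷ cs) zero    = ℤₚ.+-identityʳ _
times-poly p (c ∷ c′ ∷ cs) (suc k) = trans (times-cons p c (c′ ∷ cs) k) (cong (_+ℤ p (suc k) *ℤ c) (times-poly p (c′ ∷ cs) k))

timesList-cong : ∀ {p p′ : Poly} → (∀ k → p k ≡ p′ k) → ∀ cs k → timesList p cs k ≡ timesList p′ cs k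
timesList-cong h []            k       = refl
timesList-cong h (c ∷ [])      k       = cong (_*ℤ c) (h k)
timesList-cong h (c ∷ c′ ∷ cs) zero    = cong (_*ℤ c) (h 0)
timesList-cong h (c ∷ c′ ∷ cs) (suc k) = cong₂ _+ℤ_ (timesList-cong h (c′ ∷ cs) k) (cong (_*ℤ c) (h (suc k)))

kostantℤ : ℕ → Poly
kostantℤ i k = ℤ.+ kostant i k

genSeries-kostant : ∀ i k → genSeries i k ≡ kostantℤ i k
genSeries-kostant zero    k       = refl
genSeries-kostant (suc b) zero    = refl
genSeries-kostant (suc b) (suc k) = cong ℤ.+_ (partitionsB-kostant b (suc k))

denominatorCoeffs : ℕ → List ℤ
denominatorCoeffs 0 = ℤ.+ 1 ∷ []
denominatorCoeffs 1 = ℤ.- ℤ.+ 2 ∷ ℤ.- ℤ.+ 2 ∷ ℤ.- ℤ.+ 1 ∷ []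
denominatorCoeffs 2 = ℤ.+ 1 ∷ ℤ.+ 2 ∷ ℤ.+ 1 ∷ ℤ.+ 1 ∷ []
denominatorCoeffs (suc (suc (suc _))) = []

denominator-coeffs : ∀ j → denominator j ≡ poly (denominatorCoeffs j)
denominator-coeffs 0                   = refl
denominator-coeffs 1                   = refl
denominator-coeffs 2                   = refl
denominator-coeffs (suc (suc (suc _))) = refl

coefficient-expansion : ∀ n k →
  (genSeries *ₛ denominator) n k ≡ Σℤ (suc n) (λ i → timesList (kostantℤ i) (denominatorCoeffs (n ∸ i)) k)
coefficient-expansion n k = trans (series-product genSeries denominator n k) (Σℤ-cong (suc n) term)
  where
  term : ∀ i → i < suc n → (genSeries i *ₚ denominator (n ∸ i)) k ≡ timesList (kostantℤ i) (denominatorCoeffs (n ∸ i)) k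
  term i _ = trans (cong (λ d → (genSeries i *ₚ d) k) (denominator-coeffs (n ∸ i)))
                   (trans (times-poly (genSeries i) (denominatorCoeffs (n ∸ i)) k)
                          (timesList-cong (genSeries-kostant i) (denominatorCoeffs (n ∸ i)) k))

-- The coefficients of x^1, x^2, x^3 are computed directly (beyond the degree shown,
-- every coefficient of q vanishes on both sides).
coefficient-1 : ∀ k → Σℤ 2 (λ i → timesList (kostantℤ i) (denominatorCoeffs (1 ∸ i)) k) ≡ numerator 1 k
coefficient-1 zero                = refl
coefficient-1 (suc zero)          = refl
coefficient-1 (suc (suc zero))    = refl
coefficient-1 (suc (suc (suc k))) = refl

coefficient-2 : ∀ k → Σℤ 3 (λ i → timesList (kostantℤ i) (denominatorCoeffs (2 ∸ i)) k) ≡ numerator 2 k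
coefficient-2 zero                      = refl
coefficient-2 (suc zero)                = refl
coefficient-2 (suc (suc zero))          = refl
coefficient-2 (suc (suc (suc zero)))    = refl
coefficient-2 (suc (suc (suc (suc k)))) = refl

coefficient-3 : ∀ k → Σℤ 4 (λ i → timesList (kostantℤ i) (denominatorCoeffs (3 ∸ i)) k) ≡ numerator 3 k
coefficient-3 zero                                  = refl
coefficient-3 (suc zero)                            = refl
coefficient-3 (suc (suc zero))                      = refl
coefficient-3 (suc (suc (suc zero)))                = refl
coefficient-3 (suc (suc (suc (suc zero))))          = refl
coefficient-3 (suc (suc (suc (suc (suc zero)))))    = refl
coefficient-3 (suc (suc (suc (suc (suc (suc k)))))) = refl

-- The ℤ-form of one coefficient of the recurrence: with a, b, c the coefficients
-- of three consecutive P's, the identity c₃ + a₃ + 2a₂ + a₁ + a₀ = 2b₃ + 2b₂ + b₁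
-- in ℕ makes the corresponding coefficient of the product vanish.
recurrence-ℤ : ∀ (a0 a1 a2 a3 b1 b2 b3 c3 : ℕ) → c3 + a3 + 2 * a2 + a1 + a0 ≡ 2 * b3 + 2 * b2 + b1 →
  ℤ.+ 0 +ℤ (ℤ.+ a0 *ℤ ℤ.+ 1 +ℤ ℤ.+ a1 *ℤ ℤ.+ 1 +ℤ ℤ.+ a2 *ℤ ℤ.+ 2 +ℤ ℤ.+ a3 *ℤ ℤ.+ 1)
    +ℤ (ℤ.+ b1 *ℤ ℤ.- ℤ.+ 1 +ℤ ℤ.+ b2 *ℤ ℤ.- ℤ.+ 2 +ℤ ℤ.+ b3 *ℤ ℤ.- ℤ.+ 2) +ℤ ℤ.+ c3 *ℤ ℤ.+ 1
  ≡ ℤ.+ 0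
recurrence-ℤ a0 a1 a2 a3 b1 b2 b3 c3 balance = begin
  _ ≡⟨ rearrange (ℤ.+ a0) (ℤ.+ a1) (ℤ.+ a2) (ℤ.+ a3) (ℤ.+ b1) (ℤ.+ b2) (ℤ.+ b3) (ℤ.+ c3) ⟩
  ℤ.+ c3 +ℤ ℤ.+ a3 +ℤ ℤ.+ 2 *ℤ ℤ.+ a2 +ℤ ℤ.+ a1 +ℤ ℤ.+ a0 -ℤ (ℤ.+ 2 *ℤ ℤ.+ b3 +ℤ ℤ.+ 2 *ℤ ℤ.+ b2 +ℤ ℤ.+ b1)
    ≡⟨ cong₂ _-ℤ_ (sym castL) (sym castR) ⟩
  ℤ.+ (c3 + a3 + 2 * a2 + a1 + a0) -ℤ ℤ.+ (2 * b3 + 2 * b2 + b1)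
    ≡⟨ cong (λ w → ℤ.+ w -ℤ ℤ.+ (2 * b3 + 2 * b2 + b1)) balance ⟩
  ℤ.+ (2 * b3 + 2 * b2 + b1) -ℤ ℤ.+ (2 * b3 + 2 * b2 + b1)
    ≡⟨ ℤₚ.+-inverseʳ (ℤ.+ (2 * b3 + 2 * b2 + b1)) ⟩
  ℤ.+ 0 ∎
  where
  open ≡-Reasoning
  rearrange : ∀ (A0 A1 A2 A3 B1 B2 B3 C3 : ℤ) →
    ℤ.+ 0 +ℤ (A0 *ℤ ℤ.+ 1 +ℤ A1 *ℤ ℤ.+ 1 +ℤ A2 *ℤ ℤ.+ 2 +ℤ A3 *ℤ ℤ.+ 1)
      +ℤ (B1 *ℤ ℤ.- ℤ.+ 1 +ℤ B2 *ℤ ℤ.- ℤ.+ 2 +ℤ B3 *ℤ ℤ.- ℤ.+ 2) +ℤ C3 *ℤ ℤ.+ 1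
    ≡ C3 +ℤ A3 +ℤ ℤ.+ 2 *ℤ A2 +ℤ A1 +ℤ A0 -ℤ (ℤ.+ 2 *ℤ B3 +ℤ ℤ.+ 2 *ℤ B2 +ℤ B1)
  rearrange = ℤ-Solver.solve-∀
  castL : ℤ.+ (c3 + a3 + 2 * a2 + a1 + a0) ≡ ℤ.+ c3 +ℤ ℤ.+ a3 +ℤ ℤ.+ 2 *ℤ ℤ.+ a2 +ℤ ℤ.+ a1 +ℤ ℤ.+ a0
  castL = trans (ℤₚ.pos-+ _ a0) (cong (_+ℤ ℤ.+ a0) (trans (ℤₚ.pos-+ _ a1) (cong (_+ℤ ℤ.+ a1)
            (trans (ℤₚ.pos-+ (c3 + a3) (2 * a2)) (cong₂ _+ℤ_ (ℤₚ.pos-+ c3 a3) (ℤₚ.pos-* 2 a2))))))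
  castR : ℤ.+ (2 * b3 + 2 * b2 + b1) ≡ ℤ.+ 2 *ℤ ℤ.+ b3 +ℤ ℤ.+ 2 *ℤ ℤ.+ b2 +ℤ ℤ.+ b1
  castR = trans (ℤₚ.pos-+ _ b1) (cong (_+ℤ ℤ.+ b1) (trans (ℤₚ.pos-+ (2 * b3) (2 * b2))
            (cong₂ _+ℤ_ (ℤₚ.pos-* 2 b3) (ℤₚ.pos-* 2 b2))))

-- For r ≥ 1 the coefficients P_{B_{r+1}}, P_{B_{r+2}}, P_{B_{r+3}} are q E(v), q E(Mv),
-- q E(M²v) for v = (Q r, S r); cayleyHamilton makes the coefficient of x^{r+3} vanish.
recurrence-coefficient : ∀ m k →
  ℤ.+ 0 +ℤ timesList (kostantℤ (2 + m)) (denominatorCoeffs 2) k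
        +ℤ timesList (kostantℤ (3 + m)) (denominatorCoeffs 1) k
        +ℤ timesList (kostantℤ (4 + m)) (denominatorCoeffs 0) k
  ≡ ℤ.+ 0
recurrence-coefficient m zero                = refl
recurrence-coefficient m (suc zero)          =
  recurrence-ℤ 0 0 0 (kostant (2 + m) 1) 0 0 (kostant (3 + m) 1) (kostant (4 + m) 1)
    (cayleyHamilton (Q (suc m)) (S (suc m)) 0)
recurrence-coefficient m (suc (suc zero))    =
  recurrence-ℤ 0 0 (kostant (2 + m) 1) (kostant (2 + m) 2) 0 (kostant (3 + m) 1) (kostant (3 + m) 2) (kostant (4 + m) 2)
    (cayleyHamilton (Q (suc m)) (S (suc m)) 1)
recurrence-coefficient m (suc (suc (suc k))) =
  recurrence-ℤ (kostant (2 + m) k) (kostant (2 + m) (1 + k)) (kostant (2 + m) (2 + k)) (kostant (2 + m) (3 + k))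
               (kostant (3 + m) (1 + k)) (kostant (3 + m) (2 + k)) (kostant (3 + m) (3 + k)) (kostant (4 + m) (3 + k))
    (cayleyHamilton (Q (suc m)) (S (suc m)) (2 + k))

-- The coefficient of x^{m+4}: only the last three terms of the Cauchy product survive.
coefficient-large : ∀ m k →
  Σℤ (5 + m) (λ i → timesList (kostantℤ i) (denominatorCoeffs ((4 + m) ∸ i)) k) ≡ ℤ.+ 0
coefficient-large m k =
  trans (cong₂ (λ a b → a +ℤ b +ℤ term (3 + m) +ℤ term (4 + m)) early (last 2 (2 + m) (m+n∸n≡m 2 m)))
        (trans (cong₂ (λ a b → ℤ.+ 0 +ℤ timesList (kostantℤ (2 + m)) (denominatorCoeffs 2) k +ℤ a +ℤ b)
                      (last 1 (3 + m) (m+n∸n≡m 1 m)) (last 0 (4 + m) (n∸n≡0 m)))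
               (recurrence-coefficient m k))
  where
  term : ℕ → ℤ
  term i = timesList (kostantℤ i) (denominatorCoeffs ((4 + m) ∸ i)) k
  early : Σℤ (2 + m) term ≡ ℤ.+ 0
  early = Σℤ-zero (2 + m) term
    (λ i i<2+m → cong (λ j → timesList (kostantℤ i) (denominatorCoeffs j) k) (+-∸-assoc 3 (≤-pred i<2+m)))
  last : ∀ j i → (4 + m) ∸ i ≡ j → term i ≡ timesList (kostantℤ i) (denominatorCoeffs j) k
  last j i eq = cong (λ j → timesList (kostantℤ i) (denominatorCoeffs j) k) eq

theorem3p8 : (n k : ℕ) → (genSeries *ₛ denominator) n k ≡ numerator n k
theorem3p8 0                         k = coefficient-expansion 0 k
theorem3p8 1                         k = trans (coefficient-expansion 1 k) (coefficient-1 k)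
theorem3p8 2                         k = trans (coefficient-expansion 2 k) (coefficient-2 k)
theorem3p8 3                         k = trans (coefficient-expansion 3 k) (coefficient-3 k)
theorem3p8 (suc (suc (suc (suc m)))) k = trans (coefficient-expansion (4 + m) k) (coefficient-large m k)
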